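{- The logic $\mathbf{LCR}$ is decidable: there is an algorithm that, given a formula $\phi$ of $\mathcal{L}_{\succ}$, decides whether $\vdash_{\mathbf{LCR}}\phi$.
   Context: Fix an integer $m\ge 2$ and let $\mathcal{T}=\{0,\frac{1}{m-1},\dots,\frac{m-2}{m-1},1\}$ with its natural order. For $a,b\in\mathcal{T}$ put $a\odot b=\max\{0,a+b-1\}$. The language $\mathcal{L}_{\succ}$ has a countable set $\Pi$ of propositional variables, the unary connective $\neg$ and the binary connectives $\rightarrow$ and $\succ$; formulae are built as usual. Abbreviations: $\mathbf{t}:=p\rightarrow p$ (for a fixed variable $p$), $\phi\vee\psi:=(\phi\rightarrow\psi)\rightarrow\psi$, $\phi\wedge\psi:=\neg(\neg\phi\vee\neg\psi)$, $\phi\leftrightarrow\psi:=(\phi\rightarrow\psi)\wedge(\psi\rightarrow\phi)$. For $a\in\mathcal{T}$, $\mathbf{J}_a(\phi)$ is a fixed formula built from $\phi$ with $\neg,\rightarrow$ (the Rosser–Turquette $J$-operator of Łukasiewicz $m$-valued logic) whose value is $1$ if the value of $\phi$ is $a$ and $0$ otherwise; $\mathbf{I}_a(\phi):=\mathbf{J}_a(\phi)\vee\dots\vee\mathbf{J}_1(\phi)$ (disjunction over all $b\in\mathcal{T}$ with $b\ge a$). Iterated implication: $\rightarrow_{i=1}^{0}(\phi_i,\psi):=\psi$ and $\rightarrow_{i=1}^{k}(\phi_i,\psi):=\phi_k\rightarrow(\rightarrow_{i=1}^{k-1}(\phi_i,\psi))$. The system $\mathbf{LCR}$: all $\mathcal{L}_{\succ}$-instances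 of the axioms of a (complete) axiomatization of Łukasiewicz $m$-valued propositional logic $\mathbf{L}$ with modus ponens (MP), plus the axioms A1: $(\phi\succ(\psi\wedge\theta))\rightarrow((\phi\succ\psi)\wedge(\phi\succ\theta))$; A2: $((\phi\succ\psi)\wedge(\phi\succ\theta))\rightarrow(\phi\succ(\psi\wedge\theta))$; A3: $\phi\succ\mathbf{t}$; and the rules (RCEA): from $\phi\leftrightarrow\psi$ infer $(\phi\succ\theta)\leftrightarrow(\psi\succ\theta)$; (RCEC): from $\phi\leftrightarrow\psi$ infer $(\theta\succ\phi)\leftrightarrow(\theta\succ\psi)$; $(\mathrm{R}_a)$ for each $a\in\mathcal{T}$: from $\rightarrow_{i=1}^{m}(\mathbf{I}_{a_i\odot b}(\gamma_i),\mathbf{I}_{a\odot b}(\gamma))$ for every $b\in\mathcal{T}$, infer $\rightarrow_{i=1}^{m}(\mathbf{I}_{a_i}(\phi\succ\gamma_i),\mathbf{I}_{a}(\phi\succ\gamma))$, where $a_i=\frac{m-i}{m-1}$. $\vdash_{\mathbf{LCR}}\phi$ means $\phi$ is a theorem of $\mathbf{LCR}$. -}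

module Defs where

open import Data.Nat using (ℕ; zero; suc; _+_; _∸_; _≤_; _≡ᵇ_)
open import Data.Bool using (if_then_else_)
open import Relation.Binary.PropositionalEquality using (_≡_)

infixr 5 _⇒_
infix 6 _≻_
data Form : Set where
  var  : ℕ → Form
  ¬'_  : Form → Form
  _⇒_  : Form → Form → Form
  _≻_  : Form → Form → Form

data LForm : Set where
  lvar : ℕ → LForm
  lneg : LForm → LForm
  limp : LForm → LForm → LForm

inst : (ℕ → Form) → LForm → Form
inst σ (lvar i)   = σ i
inst σ (lneg ψ)   = ¬' inst σ ψ
inst σ (limp ψ χ) = inst σ ψ ⇒ inst σ χ

-- Truth values: with m = n + 1, the natural number k ≤ n stands for k/(m-1) = k/n.
-- Łukasiewicz semantics: ¬a = 1 - a, a → b = min(1, 1 - a + b).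
evalL : (n : ℕ) → (ℕ → ℕ) → LForm → ℕ
evalL n v (lvar i)   = v i
evalL n v (lneg ψ)   = n ∸ evalL n v ψ
evalL n v (limp ψ χ) = n ∸ (evalL n v ψ ∸ evalL n v χ)

Valuation : ℕ → (ℕ → ℕ) → Set
Valuation n v = ∀ i → v i ≤ n

Taut : ℕ → LForm → Set
Taut n ψ = ∀ v → Valuation n v → evalL n v ψ ≡ n

-- J : ℕ → LForm is a Rosser–Turquette J-operator: J k (a formula whose
-- variable stands for the argument) takes value 1 iff the argument has value k/n.
IsJ : ℕ → (ℕ → LForm) → Set
IsJ n J = ∀ k → k ≤ n → ∀ v → Valuation n v →
  evalL n v (J k) ≡ (if v 0 ≡ᵇ k then n else 0)

t : Form
t = var 0 ⇒ var 0

infixr 4 _∨'_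
infixr 4 _∧'_
_∨'_ : Form → Form → Form
φ ∨' ψ = (φ ⇒ ψ) ⇒ ψ

_∧'_ : Form → Form → Form
φ ∧' ψ = ¬' ((¬' φ) ∨' (¬' ψ))

_⇔_ : Form → Form → Form
φ ⇔ ψ = (φ ⇒ ψ) ∧' (ψ ⇒ φ)

module Ops (n : ℕ) (J : ℕ → LForm) where

  Jf : ℕ → Form → Form
  Jf k φ = inst (λ _ → φ) (J k)

  Iaux : ℕ → ℕ → Form → Form
  Iaux zero    k φ = Jf k φ
  Iaux (suc c) k φ = Jf k φ ∨' Iaux c (suc k) φ

  If : ℕ → Form → Form
  If k φ = Iaux (n ∸ k) k φ

  -- a ⊙ b on indices: max(0, a + b - 1)
  _⊙_ : ℕ → ℕ → ℕ
  a ⊙ b = (a + b) ∸ n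

  -- index of a_i = (m - i)/(m - 1), m = n + 1
  aᵢ : ℕ → ℕ
  aᵢ i = suc n ∸ i

  itImp : ℕ → (ℕ → Form) → Form → Form
  itImp zero    f ψ = ψ
  itImp (suc k) f ψ = f (suc k) ⇒ itImp k f ψ

data LCR⊢ (n : ℕ) (J : ℕ → LForm) : Form → Set where
  axL  : (ψ : LForm) → Taut n ψ → (σ : ℕ → Form) → LCR⊢ n J (inst σ ψ)
  mp   : ∀ {φ ψ} → LCR⊢ n J φ → LCR⊢ n J (φ ⇒ ψ) → LCR⊢ n J ψ
  A1   : ∀ φ ψ θ → LCR⊢ n J ((φ ≻ (ψ ∧' θ)) ⇒ ((φ ≻ ψ) ∧' (φ ≻ θ)))
  A2   : ∀ φ ψ θ → LCR⊢ n J (((φ ≻ ψ) ∧' (φ ≻ θ)) ⇒ (φ ≻ (ψ ∧' θ)))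
  A3   : ∀ φ → LCR⊢ n J (φ ≻ t)
  RCEA : ∀ {φ ψ} θ → LCR⊢ n J (φ ⇔ ψ) → LCR⊢ n J ((φ ≻ θ) ⇔ (ψ ≻ θ))
  RCEC : ∀ {φ ψ} θ → LCR⊢ n J (φ ⇔ ψ) → LCR⊢ n J ((θ ≻ φ) ⇔ (θ ≻ ψ))
  Ra   : ∀ a → a ≤ n → ∀ φ (γs : ℕ → Form) (γ : Form) →
         (∀ b → b ≤ n →
           LCR⊢ n J (Ops.itImp n J (suc n)
                       (λ i → Ops.If n J (Ops._⊙_ n J (Ops.aᵢ n J i) b) (γs i))
                       (Ops.If n J (Ops._⊙_ n J a b) γ))) →
         LCR⊢ n J (Ops.itImp n J (suc n)
                     (λ i → Ops.If n J (Ops.aᵢ n J i) (φ ≻ γs i))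
                     (Ops.If n J a (φ ≻ γ)))

module Submission where

open import Defs
open import Data.Nat as ℕ using (ℕ; zero; suc; _+_; _∸_; _≤_; _<_; _⊓_; _⊔_; z≤n; s≤s; _≡ᵇ_; _≤?_; _<?_)
open import Data.Nat.Properties hiding (_≟_)
open import Data.Bool using (true; if_then_else_)
open import Data.Bool.Properties using (T-≡; ¬-not)
open import Data.List using (List; []; _∷_; _++_; map; concatMap; filter; upTo)
open import Data.List.Properties using (∷-injective)
open import Data.List.Relation.Unary.All as All using (All; []; _∷_)
open import Data.List.Relation.Unary.All.Properties using (¬All⇒Any¬; concat⁺; map⁺; ++⁺)
open import Data.List.Relation.Unary.Any using (here; there)
open import Data.List.Membership.Propositional using (_∈_; find; lose)
open import Data.List.Membership.Propositional.Properties using (∈-++⁺ˡ; ∈-++⁺ʳ; ∈-++⁻; ∈-map⁺; ∈-map⁻; ∈-concatMap⁺; ∈-concatMap⁻; ∈-filter⁺; ∈-filter⁻; ∈-upTo⁺; ∈-upTo⁻)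
open import Data.Product using (Σ; ∃-syntax; _×_; _,_; proj₁; proj₂; uncurry)
open import Data.Sum as Sum using (_⊎_; inj₁; inj₂)
open import Data.Unit using (⊤)
open import Function using (_∘_)
open import Function.Bundles using (Equivalence)
open import Relation.Nullary using (¬_; Dec; yes; no; contradiction)
open import Relation.Nullary.Decidable using (map′; _×-dec_; _→-dec_)
open import Relation.Unary using (Decidable)
open import Relation.Binary.Definitions using (DecidableEquality)
open import Relation.Binary.PropositionalEquality
open import Algebra.Properties.CommutativeSemigroup ⊓-commutativeSemigroup using (interchange)

-- LCR is sound for tree models (see Tree), and by induction on the nesting depth of ≻ every formula χ is
-- either derivable or refuted in one. The induction hypothesis decides all shallower formulas, hence the
-- premises of the finitely many instances of R_a concerning the conditionals α ≻ β of χ; let Fs be the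
-- conclusions of those instances that are derivable. Treating variables and conditionals as atoms, either χ
-- follows from Fs in (n+1)-valued Łukasiewicz logic, and is then derivable from an instance of an
-- L-tautology, or some valuation satisfies Fs but not χ. That valuation becomes the root of a tree model
-- whose children are countermodels supplied by the induction hypothesis: they separate antecedents that are
-- not provably equivalent, and refute premises of R_a, so that together with Fs the root gives each
-- α ≻ β exactly the value the valuation assigned to it.

if-≡ᵇ-yes : ∀ {x k} {a b : ℕ} → x ≡ k → (if x ≡ᵇ k then a else b) ≡ a
if-≡ᵇ-yes {x} {k} x≡k rewrite Equivalence.to T-≡ (≡⇒≡ᵇ x k x≡k) = refl

if-≡ᵇ-no : ∀ {x k} {a b : ℕ} → x ≢ k → (if x ≡ᵇ k then a else b) ≡ b
if-≡ᵇ-no {x} {k} x≢k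
  rewrite ¬-not {x ≡ᵇ k} {true} (λ eq → x≢k (≡ᵇ⇒≡ x k (Equivalence.from T-≡ eq))) = refl

module Łukasiewicz (n : ℕ) where

  ¬ₗ_ : ℕ → ℕ
  ¬ₗ x = n ∸ x

  infixr 5 _⇒ₗ_
  _⇒ₗ_ : ℕ → ℕ → ℕ
  x ⇒ₗ y = n ∸ (x ∸ y)

  _⊙_ : ℕ → ℕ → ℕ
  a ⊙ b = (a + b) ∸ n

  ⇒ₗ≡n⇒≤ : ∀ {x y} → x ≤ n → x ⇒ₗ y ≡ n → x ≤ y
  ⇒ₗ≡n⇒≤ {x} {y} x≤n eq = m∸n≡0⇒m≤n (∸-cancelˡ-≡ (≤-trans (m∸n≤m x y) x≤n) z≤n eq)

  ≤⇒⇒ₗ≡n : ∀ {x y} → x ≤ y → x ⇒ₗ y ≡ n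
  ≤⇒⇒ₗ≡n x≤y = cong (n ∸_) (m≤n⇒m∸n≡0 x≤y)

  ∨ₗ≡⊔ : ∀ {x y} → x ≤ n → y ≤ n → (x ⇒ₗ y) ⇒ₗ y ≡ x ⊔ y
  ∨ₗ≡⊔ {x} {y} x≤n y≤n with ≤-total x y
  ... | inj₁ x≤y rewrite m≤n⇒m∸n≡0 x≤y | m≤n⇒m⊔n≡n x≤y = m∸[m∸n]≡n y≤n
  ... | inj₂ y≤x rewrite m≥n⇒m⊔n≡m y≤x | ∸-+-assoc n (x ∸ y) y | m∸n+n≡m y≤x = m∸[m∸n]≡n x≤n

  ≤⇒ₗ⇒⊙≤ : ∀ {a r y} → r ≤ n → a ≤ r ⇒ₗ y → a ⊙ r ≤ y
  ≤⇒ₗ⇒⊙≤ {a} {r} {y} r≤n a≤ = m≤n+o⇒m∸n≤o (a + r) n (begin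
    a + r             ≤⟨ +-monoʳ-≤ a (m≤n+m∸n r y) ⟩
    a + (y + (r ∸ y)) ≡⟨ cong (a +_) (+-comm y (r ∸ y)) ⟩
    a + ((r ∸ y) + y) ≡⟨ +-assoc a (r ∸ y) y ⟨
    a + (r ∸ y) + y   ≤⟨ +-monoˡ-≤ y (m≤o∸n⇒m+n≤o a (≤-trans (m∸n≤m r y) r≤n) a≤) ⟩
    n + y             ∎)
    where open ≤-Reasoning

  ⊙≤⇒≤⇒ₗ : ∀ {a r y} → a ≤ n → a ⊙ r ≤ y → a ≤ r ⇒ₗ y
  ⊙≤⇒≤⇒ₗ {a} {r} {y} a≤n a⊙r≤y with ≤-total r y
  ... | inj₁ r≤y rewrite m≤n⇒m∸n≡0 r≤y = a≤n
  ... | inj₂ y≤r = m+n≤o⇒m≤o∸n a (+-cancelʳ-≤ y (a + (r ∸ y)) n (begin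
    a + (r ∸ y) + y   ≡⟨ +-assoc a (r ∸ y) y ⟩
    a + ((r ∸ y) + y) ≡⟨ cong (a +_) (m∸n+n≡m y≤r) ⟩
    a + r             ≤⟨ m≤n+m∸n (a + r) n ⟩
    n + a ⊙ r         ≤⟨ +-monoʳ-≤ n a⊙r≤y ⟩
    n + y             ∎))
    where open ≤-Reasoning

  <n⇒⇒ₗ-increasing : ∀ {x k y} → x < n → k < n → k ≤ y → suc k ≤ x ⇒ₗ y
  <n⇒⇒ₗ-increasing {x} {k} {y} x<n k<n k≤y = ⊙≤⇒≤⇒ₗ k<n (m≤n+o⇒m∸n≤o (suc k + x) n (begin
    suc k + x ≡⟨ +-suc k x ⟨
    k + suc x ≤⟨ +-mono-≤ k≤y x<n ⟩
    y + n     ≡⟨ +-comm y n ⟩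
    n + y     ∎))
    where open ≤-Reasoning

  0⇒ₗ≡n : ∀ y → 0 ⇒ₗ y ≡ n
  0⇒ₗ≡n y = cong (n ∸_) (0∸n≡0 y)

  <⊙⇒⇒ₗ< : ∀ {a b y} → b ≤ n → y < a ⊙ b → b ⇒ₗ y < a
  <⊙⇒⇒ₗ< b≤n y<a⊙b = ≰⇒> λ a≤b⇒y → <⇒≱ y<a⊙b (≤⇒ₗ⇒⊙≤ b≤n a≤b⇒y)

  ⊙-≤n : ∀ {x b} → x ≤ n → b ≤ n → x ⊙ b ≤ n
  ⊙-≤n {x} {b} x≤n b≤n = m≤n+o⇒m∸n≤o (x + b) n (+-mono-≤ x≤n b≤n)

module _ (n : ℕ) where
  open Łukasiewicz n

  record IsEvaluation (e : Form → ℕ) : Set where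
    field
      eval-¬ : ∀ φ → e (¬' φ) ≡ ¬ₗ e φ
      eval-⇒ : ∀ φ ψ → e (φ ⇒ ψ) ≡ e φ ⇒ₗ e ψ
      eval-≤ : ∀ φ → e φ ≤ n

⋀ : List Form → Form
⋀ []       = t
⋀ (φ ∷ φs) = φ ∧' ⋀ φs

AllUpTo : ℕ → (ℕ → Set) → Set
AllUpTo k P = ∀ i → 1 ≤ i → i ≤ k → P i

AllUpTo-zero : ∀ {P} → AllUpTo 0 P
AllUpTo-zero i 1≤i i≤0 = contradiction (≤-trans 1≤i i≤0) λ ()

AllUpTo-last : ∀ {k P} → AllUpTo (suc k) P → P (suc k)
AllUpTo-last hs = hs _ (s≤s z≤n) ≤-refl

AllUpTo-init : ∀ {k P} → AllUpTo (suc k) P → AllUpTo k P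
AllUpTo-init hs i 1≤i i≤k = hs i 1≤i (m≤n⇒m≤1+n i≤k)

AllUpTo-snoc : ∀ {k P} → AllUpTo k P → P (suc k) → AllUpTo (suc k) P
AllUpTo-snoc hs p i 1≤i i≤1+k with m≤n⇒m<n∨m≡n i≤1+k
... | inj₁ (s≤s i≤k) = hs i 1≤i i≤k
... | inj₂ refl      = p

module EvaluationProperties {n : ℕ} {e : Form → ℕ} (isEval : IsEvaluation n e) where
  open Łukasiewicz n
  open IsEvaluation isEval

  ⇒-≡n⇒≤ : ∀ φ ψ → e (φ ⇒ ψ) ≡ n → e φ ≤ e ψ
  ⇒-≡n⇒≤ φ ψ eq = ⇒ₗ≡n⇒≤ (eval-≤ φ) (trans (sym (eval-⇒ φ ψ)) eq)

  ≤⇒⇒-≡n : ∀ φ ψ → e φ ≤ e ψ → e (φ ⇒ ψ) ≡ n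
  ≤⇒⇒-≡n φ ψ le = trans (eval-⇒ φ ψ) (≤⇒⇒ₗ≡n le)

  ≥n⇒≡n : ∀ {φ} → n ≤ e φ → e φ ≡ n
  ≥n⇒≡n {φ} = ≤-antisym (eval-≤ φ)

  ⇒-≡n-both⇒≡ : ∀ φ ψ → e (φ ⇒ ψ) ≡ n → e (ψ ⇒ φ) ≡ n → e φ ≡ e ψ
  ⇒-≡n-both⇒≡ φ ψ φ⇒ψ ψ⇒φ = ≤-antisym (⇒-≡n⇒≤ φ ψ φ⇒ψ) (⇒-≡n⇒≤ ψ φ ψ⇒φ)

  mp-≡n : ∀ φ ψ → e φ ≡ n → e (φ ⇒ ψ) ≡ n → e ψ ≡ n
  mp-≡n φ ψ φ≡n φ⇒ψ≡n = ≥n⇒≡n (subst (_≤ e ψ) φ≡n (⇒-≡n⇒≤ φ ψ φ⇒ψ≡n))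

  ∨-≡⊔ : ∀ φ ψ → e (φ ∨' ψ) ≡ e φ ⊔ e ψ
  ∨-≡⊔ φ ψ rewrite eval-⇒ (φ ⇒ ψ) ψ | eval-⇒ φ ψ = ∨ₗ≡⊔ (eval-≤ φ) (eval-≤ ψ)

  ∧-≡⊓ : ∀ φ ψ → e (φ ∧' ψ) ≡ e φ ⊓ e ψ
  ∧-≡⊓ φ ψ rewrite eval-¬ ((¬' φ) ∨' (¬' ψ)) | ∨-≡⊔ (¬' φ) (¬' ψ) | eval-¬ φ | eval-¬ ψ
    | ∸-distribˡ-⊔-⊓ n (n ∸ e φ) (n ∸ e ψ)
    | m∸[m∸n]≡n (eval-≤ φ) | m∸[m∸n]≡n (eval-≤ ψ) = refl

  ∧-≡n⇒≡n : ∀ φ ψ → e (φ ∧' ψ) ≡ n → e φ ≡ n × e ψ ≡ n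
  ∧-≡n⇒≡n φ ψ eq = ≥n⇒≡n (subst (_≤ e φ) ⊓≡n (m⊓n≤m _ _)) , ≥n⇒≡n (subst (_≤ e ψ) ⊓≡n (m⊓n≤n _ _))
    where ⊓≡n = trans (sym (∧-≡⊓ φ ψ)) eq

  ⇔-≡n⇒≡ : ∀ φ ψ → e (φ ⇔ ψ) ≡ n → e φ ≡ e ψ
  ⇔-≡n⇒≡ φ ψ eq = let φ⇒ψ , ψ⇒φ = ∧-≡n⇒≡n (φ ⇒ ψ) (ψ ⇒ φ) eq in ⇒-≡n-both⇒≡ φ ψ φ⇒ψ ψ⇒φ

  ≡⇒⇔-≡n : ∀ φ ψ → e φ ≡ e ψ → e (φ ⇔ ψ) ≡ n
  ≡⇒⇔-≡n φ ψ eq rewrite ∧-≡⊓ (φ ⇒ ψ) (ψ ⇒ φ)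
    | ≤⇒⇒-≡n φ ψ (≤-reflexive eq) | ≤⇒⇒-≡n ψ φ (≤-reflexive (sym eq)) = ⊓-idem n

  t-≡n : e t ≡ n
  t-≡n = ≤⇒⇒-≡n (var 0) (var 0) ≤-refl

  inst-≡evalL : ∀ σ ψ → e (inst σ ψ) ≡ evalL n (λ i → e (σ i)) ψ
  inst-≡evalL σ (lvar i)   = refl
  inst-≡evalL σ (lneg ψ)   rewrite eval-¬ (inst σ ψ) | inst-≡evalL σ ψ = refl
  inst-≡evalL σ (limp ψ χ)
    rewrite eval-⇒ (inst σ ψ) (inst σ χ) | inst-≡evalL σ ψ | inst-≡evalL σ χ = refl

  ⋀-glb : ∀ {k} φs → k ≤ n → All (λ φ → k ≤ e φ) φs → k ≤ e (⋀ φs)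
  ⋀-glb []       k≤n []       = subst (_ ≤_) (sym t-≡n) k≤n
  ⋀-glb (φ ∷ φs) k≤n (p ∷ ps) rewrite ∧-≡⊓ φ (⋀ φs) = ⊓-glb p (⋀-glb φs k≤n ps)

  ⋀-≤ : ∀ {φ} φs → φ ∈ φs → e (⋀ φs) ≤ e φ
  ⋀-≤ (ψ ∷ φs) (here refl) rewrite ∧-≡⊓ ψ (⋀ φs) = m⊓n≤m _ _
  ⋀-≤ (ψ ∷ φs) (there φ∈) rewrite ∧-≡⊓ ψ (⋀ φs) = ≤-trans (m⊓n≤n _ _) (⋀-≤ φs φ∈)

  Crisp : Form → Set
  Crisp φ = e φ ≡ n ⊎ e φ ≡ 0

module RaSchema (n : ℕ) (J : ℕ → LForm) where
  open Łukasiewicz n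
  open Ops n J hiding (_⊙_)

  aᵢ≤n : ∀ i → 1 ≤ i → aᵢ i ≤ n
  aᵢ≤n i 1≤i = ∸-monoʳ-≤ (suc n) 1≤i

  RaPremise : ℕ → (ℕ → Form) → Form → ℕ → Form
  RaPremise a γs γ b = itImp (suc n) (λ i → If (aᵢ i ⊙ b) (γs i)) (If (a ⊙ b) γ)

module ThresholdProperties {n : ℕ} (J : ℕ → LForm) {e : Form → ℕ} (isEval : IsEvaluation n e) where
  open Łukasiewicz n
  open Ops n J hiding (_⊙_)
  open RaSchema n J
  open IsEvaluation isEval
  open EvaluationProperties isEval

  itImp-elim : ∀ k f ψ → e (itImp k f ψ) ≡ n → AllUpTo k (λ i → e (f i) ≡ n) → e ψ ≡ n
  itImp-elim zero    f ψ eq _  = eq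
  itImp-elim (suc k) f ψ eq hs =
    itImp-elim k f ψ (mp-≡n (f (suc k)) _ (AllUpTo-last hs) eq) (AllUpTo-init hs)

  itImp-intro : ∀ k f ψ → AllUpTo k (λ i → Crisp (f i)) →
                (AllUpTo k (λ i → e (f i) ≡ n) → e ψ ≡ n) → e (itImp k f ψ) ≡ n
  itImp-intro zero    f ψ _  h = h AllUpTo-zero
  itImp-intro (suc k) f ψ cr h with AllUpTo-last cr
  ... | inj₂ f≡0 = ≤⇒⇒-≡n (f (suc k)) _ (subst (_≤ e (itImp k f ψ)) (sym f≡0) z≤n)
  ... | inj₁ f≡n = ≤⇒⇒-≡n (f (suc k)) _ (subst (e (f (suc k)) ≤_) (sym rest) (eval-≤ (f (suc k))))
    where
      rest : e (itImp k f ψ) ≡ n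
      rest = itImp-intro k f ψ (AllUpTo-init cr) λ hs → h (AllUpTo-snoc hs f≡n)

  itImp-cong : ∀ k f g ψ ψ′ → AllUpTo k (λ i → e (f i) ≡ e (g i)) → e ψ ≡ e ψ′ →
               e (itImp k f ψ) ≡ e (itImp k g ψ′)
  itImp-cong zero    f g ψ ψ′ _  eq = eq
  itImp-cong (suc k) f g ψ ψ′ hs eq
    rewrite eval-⇒ (f (suc k)) (itImp k f ψ) | eval-⇒ (g (suc k)) (itImp k g ψ′)
    | AllUpTo-last hs | itImp-cong k f g ψ ψ′ (AllUpTo-init hs) eq = refl

  Jf-cong : ∀ k φ ψ → e φ ≡ e ψ → e (Jf k φ) ≡ e (Jf k ψ)
  Jf-cong k φ ψ eq rewrite inst-≡evalL (λ _ → φ) (J k) | inst-≡evalL (λ _ → ψ) (J k) | eq = refl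

  Iaux-cong : ∀ c k φ ψ → e φ ≡ e ψ → e (Iaux c k φ) ≡ e (Iaux c k ψ)
  Iaux-cong zero    k φ ψ eq = Jf-cong k φ ψ eq
  Iaux-cong (suc c) k φ ψ eq rewrite ∨-≡⊔ (Jf k φ) (Iaux c (suc k) φ) | ∨-≡⊔ (Jf k ψ) (Iaux c (suc k) ψ)
    | Jf-cong k φ ψ eq | Iaux-cong c (suc k) φ ψ eq = refl

  If-cong : ∀ k φ ψ → e φ ≡ e ψ → e (If k φ) ≡ e (If k ψ)
  If-cong k = Iaux-cong (n ∸ k) k

  module Exact (n≢0 : n ≢ 0) (isJ : IsJ n J) where

    itImp-refute : ∀ k f ψ → AllUpTo k (λ i → Crisp (f i)) → e (itImp k f ψ) ≢ n →
                   AllUpTo k (λ i → e (f i) ≡ n) × e ψ ≢ n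
    itImp-refute k f ψ cr ne = premise , λ ψ≡n → ne (itImp-intro k f ψ cr λ _ → ψ≡n)
      where
        premise : AllUpTo k (λ i → e (f i) ≡ n)
        premise i 1≤i i≤k with cr i 1≤i i≤k
        ... | inj₁ f≡n = f≡n
        ... | inj₂ f≡0 = contradiction (itImp-intro k f ψ cr λ hs →
                           contradiction (trans (sym (hs i 1≤i i≤k)) f≡0) n≢0) ne

    Jf-value : ∀ k φ → k ≤ n → e (Jf k φ) ≡ (if e φ ≡ᵇ k then n else 0)
    Jf-value k φ k≤n = trans (inst-≡evalL (λ _ → φ) (J k)) (isJ k k≤n (λ _ → e φ) (λ _ → eval-≤ φ))

    Iaux-≡n : ∀ c k φ → k + c ≡ n → k ≤ e φ → e (Iaux c k φ) ≡ n
    Iaux-≡n zero k φ k+0≡n k≤φ = trans (Jf-value k φ k≤n) (if-≡ᵇ-yes (≤-antisym φ≤k k≤φ))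
      where
        k≡n : k ≡ n
        k≡n = trans (sym (+-identityʳ k)) k+0≡n
        k≤n : k ≤ n
        k≤n = ≤-reflexive k≡n
        φ≤k : e φ ≤ k
        φ≤k = subst (e φ ≤_) (sym k≡n) (eval-≤ φ)
    Iaux-≡n (suc c) k φ k+c≡n k≤φ rewrite ∨-≡⊔ (Jf k φ) (Iaux c (suc k) φ)
      with m≤n⇒m<n∨m≡n k≤φ
    ... | inj₁ k<φ rewrite Iaux-≡n c (suc k) φ (trans (sym (+-suc k c)) k+c≡n) k<φ =
      m≤n⇒m⊔n≡n (eval-≤ (Jf k φ))
    ... | inj₂ k≡φ rewrite Jf-value k φ (≤-trans (m≤m+n k (suc c)) (≤-reflexive k+c≡n))
      | if-≡ᵇ-yes {a = n} {0} (sym k≡φ) = m≥n⇒m⊔n≡m (eval-≤ _)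

    Iaux-≡0 : ∀ c k φ → k + c ≡ n → e φ < k → e (Iaux c k φ) ≡ 0
    Iaux-≡0 zero k φ k+0≡n φ<k =
      trans (Jf-value k φ (≤-reflexive (trans (sym (+-identityʳ k)) k+0≡n))) (if-≡ᵇ-no (<⇒≢ φ<k))
    Iaux-≡0 (suc c) k φ k+c≡n φ<k rewrite ∨-≡⊔ (Jf k φ) (Iaux c (suc k) φ)
      | Jf-value k φ (≤-trans (m≤m+n k (suc c)) (≤-reflexive k+c≡n))
      | if-≡ᵇ-no {a = n} {0} (<⇒≢ φ<k)
      | Iaux-≡0 c (suc k) φ (trans (sym (+-suc k c)) k+c≡n) (m<n⇒m<1+n φ<k) = refl

    If-≡n : ∀ k φ → k ≤ n → k ≤ e φ → e (If k φ) ≡ n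
    If-≡n k φ k≤n = Iaux-≡n (n ∸ k) k φ (m+[n∸m]≡n k≤n)

    If-≡0 : ∀ k φ → k ≤ n → e φ < k → e (If k φ) ≡ 0
    If-≡0 k φ k≤n = Iaux-≡0 (n ∸ k) k φ (m+[n∸m]≡n k≤n)

    If-≡n⇒≤ : ∀ k φ → k ≤ n → e (If k φ) ≡ n → k ≤ e φ
    If-≡n⇒≤ k φ k≤n eq with k ≤? e φ
    ... | yes k≤φ = k≤φ
    ... | no k≰φ  = contradiction (trans (sym eq) (If-≡0 k φ k≤n (≰⇒> k≰φ))) n≢0

    If-crisp : ∀ k φ → k ≤ n → Crisp (If k φ)
    If-crisp k φ k≤n with k ≤? e φ
    ... | yes k≤φ = inj₁ (If-≡n k φ k≤n k≤φ)
    ... | no k≰φ  = inj₂ (If-≡0 k φ k≤n (≰⇒> k≰φ))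

    RaPremise-≡n⇒ : ∀ {a b} γs γ → a ≤ n → b ≤ n → e (RaPremise a γs γ b) ≡ n →
                    AllUpTo (suc n) (λ i → aᵢ i ≤ b ⇒ₗ e (γs i)) → a ≤ b ⇒ₗ e γ
    RaPremise-≡n⇒ {a} {b} γs γ a≤n b≤n premise hs =
      ⊙≤⇒≤⇒ₗ a≤n (If-≡n⇒≤ (a ⊙ b) γ (⊙-≤n a≤n b≤n) (itImp-elim (suc n) _ _ premise
        λ i 1≤i i≤ → If-≡n (aᵢ i ⊙ b) (γs i) (⊙-≤n (aᵢ≤n i 1≤i) b≤n) (≤⇒ₗ⇒⊙≤ b≤n (hs i 1≤i i≤))))

    RaPremise-≢n⇒ : ∀ {a b} γs γ → a ≤ n → b ≤ n → e (RaPremise a γs γ b) ≢ n →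
                    AllUpTo (suc n) (λ i → aᵢ i ⊙ b ≤ e (γs i)) × e γ < a ⊙ b
    RaPremise-≢n⇒ {a} {b} γs γ a≤n b≤n premise≢n =
      (λ i 1≤i i≤ → If-≡n⇒≤ (aᵢ i ⊙ b) (γs i) (⊙-≤n (aᵢ≤n i 1≤i) b≤n) (proj₁ refuted i 1≤i i≤)) , γ<a⊙b
      where
        crisp : AllUpTo (suc n) (λ i → Crisp (If (aᵢ i ⊙ b) (γs i)))
        crisp i 1≤i _ = If-crisp (aᵢ i ⊙ b) (γs i) (⊙-≤n (aᵢ≤n i 1≤i) b≤n)
        refuted : AllUpTo (suc n) (λ i → e (If (aᵢ i ⊙ b) (γs i)) ≡ n) × e (If (a ⊙ b) γ) ≢ n
        refuted = itImp-refute (suc n) _ _ crisp premise≢n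
        γ<a⊙b : e γ < a ⊙ b
        γ<a⊙b with a ⊙ b ≤? e γ
        ... | yes a⊙b≤γ = contradiction (If-≡n (a ⊙ b) γ (⊙-≤n a≤n b≤n) a⊙b≤γ) (proj₂ refuted)
        ... | no  a⊙b≰γ = ≰⇒> a⊙b≰γ

∈-concatMap⁺′ : {A B : Set} (f : A → List B) {x : A} {y : B} {xs : List A} →
                x ∈ xs → y ∈ f x → y ∈ concatMap f xs
∈-concatMap⁺′ f x∈xs y∈fx = ∈-concatMap⁺ f (lose x∈xs y∈fx)

All-concatMap⁺ : {A B : Set} {P : B → Set} (f : A → List B) {xs : List A} →
                 (∀ {x} → x ∈ xs → All P (f x)) → All P (concatMap f xs)
All-concatMap⁺ f h = concat⁺ (map⁺ (All.tabulate h))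

infix 4 _≟_
_≟_ : DecidableEquality Form
var i   ≟ var j   = map′ (cong var) (λ { refl → refl }) (i ℕ.≟ j)
(¬' φ)  ≟ (¬' ψ)  = map′ (cong ¬'_) (λ { refl → refl }) (φ ≟ ψ)
(φ ⇒ χ) ≟ (ψ ⇒ θ) = map′ (λ (p , q) → cong₂ _⇒_ p q) (λ { refl → refl , refl }) (φ ≟ ψ ×-dec χ ≟ θ)
(φ ≻ χ) ≟ (ψ ≻ θ) = map′ (λ (p , q) → cong₂ _≻_ p q) (λ { refl → refl , refl }) (φ ≟ ψ ×-dec χ ≟ θ)
var _   ≟ ¬' _    = no λ ()
var _   ≟ _ ⇒ _   = no λ ()
var _   ≟ _ ≻ _   = no λ ()
¬' _    ≟ var _   = no λ ()
¬' _    ≟ _ ⇒ _   = no λ ()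
¬' _    ≟ _ ≻ _   = no λ ()
_ ⇒ _   ≟ var _   = no λ ()
_ ⇒ _   ≟ ¬' _    = no λ ()
_ ⇒ _   ≟ _ ≻ _   = no λ ()
_ ≻ _   ≟ var _   = no λ ()
_ ≻ _   ≟ ¬' _    = no λ ()
_ ≻ _   ≟ _ ⇒ _   = no λ ()

atoms : Form → List Form
atoms (var i) = var i ∷ []
atoms (¬' φ)  = atoms φ
atoms (φ ⇒ ψ) = atoms φ ++ atoms ψ
atoms (φ ≻ ψ) = (φ ≻ ψ) ∷ []

index : List Form → Form → ℕ
index []      a = 0
index (b ∷ L) a with a ≟ b
... | yes _ = 0
... | no _  = suc (index L a)

nth : {A : Set} → A → List A → ℕ → A
nth d []       _       = d
nth d (x ∷ xs) zero    = x
nth d (x ∷ xs) (suc k) = nth d xs k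

nth-index : ∀ {d} L {a} → a ∈ L → nth d L (index L a) ≡ a
nth-index (b ∷ L) {a} a∈ with a ≟ b
nth-index (b ∷ L) a∈          | yes a≡b  = sym a≡b
nth-index (b ∷ L) (here refl) | no a≢b   = contradiction refl a≢b
nth-index (b ∷ L) (there a∈)  | no _     = nth-index L a∈

graph : {A : Set} → (A → ℕ) → List A → List (A × ℕ)
graph f = map (λ x → x , f x)

lookupValue : List (Form × ℕ) → Form → ℕ
lookupValue []             a = 0
lookupValue ((b , v) ∷ zs) a with a ≟ b
... | yes _ = v
... | no _  = lookupValue zs a

lookupValue-graph : ∀ f L {a} → a ∈ L → lookupValue (graph f L) a ≡ f a
lookupValue-graph f (b ∷ L) {a} a∈ with a ≟ b
lookupValue-graph f (b ∷ L) a∈          | yes refl = refl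
lookupValue-graph f (b ∷ L) (here refl) | no a≢b   = contradiction refl a≢b
lookupValue-graph f (b ∷ L) (there a∈)  | no _     = lookupValue-graph f L a∈

module AtomValuations (n : ℕ) where
  open Łukasiewicz n

  evalAtoms : (Form → ℕ) → Form → ℕ
  evalAtoms V (var i) = V (var i)
  evalAtoms V (¬' φ)  = ¬ₗ evalAtoms V φ
  evalAtoms V (φ ⇒ ψ) = evalAtoms V φ ⇒ₗ evalAtoms V ψ
  evalAtoms V (φ ≻ ψ) = V (φ ≻ ψ)

  Bounded : (Form → ℕ) → Set
  Bounded V = ∀ φ → V φ ≤ n

  evalAtoms-isEvaluation : ∀ {V} → Bounded V → IsEvaluation n (evalAtoms V)
  evalAtoms-isEvaluation {V} bV = record { eval-¬ = λ _ → refl ; eval-⇒ = λ _ _ → refl ; eval-≤ = bounded }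
    where
      bounded : ∀ φ → evalAtoms V φ ≤ n
      bounded (var i) = bV _
      bounded (¬' φ)  = m∸n≤m n (evalAtoms V φ)
      bounded (φ ⇒ ψ) = m∸n≤m n (evalAtoms V φ ∸ evalAtoms V ψ)
      bounded (φ ≻ ψ) = bV _

  evalAtoms-atom : ∀ φ {a} → a ∈ atoms φ → ∀ V → evalAtoms V a ≡ V a
  evalAtoms-atom (var i) (here refl) V = refl
  evalAtoms-atom (¬' φ)  a∈ V = evalAtoms-atom φ a∈ V
  evalAtoms-atom (φ ⇒ ψ) a∈ V with ∈-++⁻ (atoms φ) a∈
  ... | inj₁ a∈φ = evalAtoms-atom φ a∈φ V
  ... | inj₂ a∈ψ = evalAtoms-atom ψ a∈ψ V
  evalAtoms-atom (φ ≻ ψ) (here refl) V = refl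

  evaluation-≡evalAtoms : ∀ {e} → IsEvaluation n e → ∀ V φ →
                          (∀ {a} → a ∈ atoms φ → e a ≡ V a) → e φ ≡ evalAtoms V φ
  evaluation-≡evalAtoms isEval V (var i) agree = agree (here refl)
  evaluation-≡evalAtoms isEval V (¬' φ)  agree
    rewrite IsEvaluation.eval-¬ isEval φ | evaluation-≡evalAtoms isEval V φ agree = refl
  evaluation-≡evalAtoms isEval V (φ ⇒ ψ) agree
    rewrite IsEvaluation.eval-⇒ isEval φ ψ
    | evaluation-≡evalAtoms isEval V φ (λ a∈ → agree (∈-++⁺ˡ a∈))
    | evaluation-≡evalAtoms isEval V ψ (λ a∈ → agree (∈-++⁺ʳ (atoms φ) a∈)) = refl
  evaluation-≡evalAtoms isEval V (φ ≻ ψ) agree = agree (here refl)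

  Holds : (Form → ℕ) → Form → Set
  Holds V φ = evalAtoms V φ ≡ n

  Entails : List Form → Form → Set
  Entails Ps Q = ∀ V → Bounded V → All (Holds V) Ps → Holds V Q

  Refutes : (Form → ℕ) → List Form → Form → Set
  Refutes V Ps Q = Bounded V × All (Holds V) Ps × ¬ Holds V Q

  profiles : {A : Set} → List A → List (List (A × ℕ))
  profiles []       = [] ∷ []
  profiles (x ∷ xs) = concatMap (λ v → map ((x , v) ∷_) (profiles xs)) (upTo (suc n))

  graph∈profiles : ∀ {A : Set} {f : A → ℕ} xs → (∀ {x} → x ∈ xs → f x ≤ n) → graph f xs ∈ profiles xs
  graph∈profiles []       _   = here refl
  graph∈profiles (x ∷ xs) f≤n = ∈-concatMap⁺′ (λ v → map ((x , v) ∷_) (profiles xs))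
    (∈-upTo⁺ (s≤s (f≤n (here refl)))) (∈-map⁺ _ (graph∈profiles xs λ x∈ → f≤n (there x∈)))

  profiles-bounded : ∀ {A : Set} (xs : List A) {zs} → zs ∈ profiles xs → All (λ p → proj₂ p ≤ n) zs
  profiles-bounded []       (here refl) = []
  profiles-bounded (x ∷ xs) zs∈
    with v , v∈upTo , zs∈map ← find (∈-concatMap⁻ (λ v → map ((x , v) ∷_) (profiles xs)) {xs = upTo (suc n)} zs∈)
    with ws , ws∈ , refl ← ∈-map⁻ ((x , v) ∷_) zs∈map
    = ≤-pred (∈-upTo⁻ v∈upTo) ∷ profiles-bounded xs ws∈

  lookupValue-bounded : ∀ {zs} → All (λ p → proj₂ p ≤ n) zs → Bounded (lookupValue zs)
  lookupValue-bounded {[]}           _            a = z≤n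
  lookupValue-bounded {(b , v) ∷ zs} (v≤n ∷ zs≤n) a with a ≟ b
  ... | yes _ = v≤n
  ... | no _  = lookupValue-bounded zs≤n a

  module Search (Ps : List Form) (Q : Form) where

    L : List Form
    L = concatMap atoms (Q ∷ Ps)

    Good : List (Form × ℕ) → Set
    Good zs = All (Holds (lookupValue zs)) Ps → Holds (lookupValue zs) Q

    holds? : ∀ V φ → Dec (Holds V φ)
    holds? V φ = evalAtoms V φ ℕ.≟ n

    good? : ∀ zs → Dec (Good zs)
    good? zs = All.all? (holds? (lookupValue zs)) Ps →-dec holds? (lookupValue zs) Q

    graph-agrees : ∀ V → Bounded V → ∀ {φ} → (∀ {a} → a ∈ atoms φ → a ∈ L) →
                   evalAtoms V φ ≡ evalAtoms (lookupValue (graph V L)) φ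
    graph-agrees V bV {φ} ⊆L = evaluation-≡evalAtoms (evalAtoms-isEvaluation bV) _ φ
      λ a∈ → trans (evalAtoms-atom φ a∈ V) (sym (lookupValue-graph V L (⊆L a∈)))

    entails-if-all-good : All Good (profiles L) → Entails Ps Q
    entails-if-all-good allGood V bV hPs =
      trans (graph-agrees V bV {Q} (∈-concatMap⁺′ atoms {xs = Q ∷ Ps} (here refl)))
            (All.lookup allGood (graph∈profiles L λ {a} _ → bV a) (All.tabulate λ {F} F∈ →
               trans (sym (graph-agrees V bV {F} (∈-concatMap⁺′ atoms {xs = Q ∷ Ps} (there F∈))))
                     (All.lookup hPs F∈)))

    refutes-if-bad : ∀ {zs} → zs ∈ profiles L → ¬ Good zs → Refutes (lookupValue zs) Ps Q
    refutes-if-bad {zs} zs∈ bad with All.all? (holds? (lookupValue zs)) Ps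
    ... | yes hPs = lookupValue-bounded (profiles-bounded L zs∈) , hPs , λ hQ → bad λ _ → hQ
    ... | no ¬hPs = contradiction (λ hPs → contradiction hPs ¬hPs) bad

    decision : Entails Ps Q ⊎ ∃[ V ] Refutes V Ps Q
    decision with All.all? good? (profiles L)
    ... | yes allGood = inj₁ (entails-if-all-good allGood)
    ... | no ¬allGood with zs , zs∈ , bad ← find (¬All⇒Any¬ good? _ ¬allGood)
      = inj₂ (lookupValue zs , refutes-if-bad zs∈ bad)

  entails? : ∀ Ps Q → Entails Ps Q ⊎ ∃[ V ] Refutes V Ps Q
  entails? = Search.decision

module Consequence (n : ℕ) (J : ℕ → LForm) where
  open Łukasiewicz n
  open AtomValuations n

  ⊢_ : Form → Set
  ⊢ φ = LCR⊢ n J φ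

  repeatImp : ℕ → Form → Form → Form
  repeatImp zero    P G = G
  repeatImp (suc k) P G = P ⇒ repeatImp k P G

  -- Local deduction theorem of (n+1)-valued Łukasiewicz logic: G follows from P iff P → ⋯ → P → G
  -- (n copies of P) is a tautology.
  deductionForm : List Form → Form → Form
  deductionForm []       Q = Q
  deductionForm (P ∷ Ps) Q = repeatImp n P (deductionForm Ps Q)

  module _ {e : Form → ℕ} (isEval : IsEvaluation n e) where
    open IsEvaluation isEval
    open EvaluationProperties isEval using (≥n⇒≡n)

    repeatImp-≡n : ∀ k P G → e P ≡ n → e (repeatImp k P G) ≡ e G
    repeatImp-≡n zero    P G _   = refl
    repeatImp-≡n (suc k) P G P≡n
      rewrite eval-⇒ P (repeatImp k P G) | P≡n | repeatImp-≡n k P G P≡n = m∸[m∸n]≡n (eval-≤ G)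

    repeatImp-≥ : ∀ k P G → e P < n → k ≤ n → k ≤ e (repeatImp k P G)
    repeatImp-≥ zero    P G _   _   = z≤n
    repeatImp-≥ (suc k) P G P<n k<n rewrite eval-⇒ P (repeatImp k P G) =
      <n⇒⇒ₗ-increasing P<n k<n (repeatImp-≥ k P G P<n (<⇒≤ k<n))

    deductionForm-≡n : ∀ Ps Q → (All (λ P → e P ≡ n) Ps → e Q ≡ n) → e (deductionForm Ps Q) ≡ n
    deductionForm-≡n []       Q h = h []
    deductionForm-≡n (P ∷ Ps) Q h with e P ℕ.≟ n
    ... | yes P≡n = trans (repeatImp-≡n n P _ P≡n) (deductionForm-≡n Ps Q λ hs → h (P≡n ∷ hs))
    ... | no P≢n  = ≥n⇒≡n (repeatImp-≥ n P _ (≤∧≢⇒< (eval-≤ P) P≢n) ≤-refl)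

  ⊢repeatImp-mp : ∀ k {P G} → ⊢ P → ⊢ repeatImp k P G → ⊢ G
  ⊢repeatImp-mp zero    ⊢P ⊢G   = ⊢G
  ⊢repeatImp-mp (suc k) ⊢P ⊢P⇒G = ⊢repeatImp-mp k ⊢P (mp ⊢P ⊢P⇒G)

  ⊢deductionForm-mp : ∀ {Ps Q} → All ⊢_ Ps → ⊢ deductionForm Ps Q → ⊢ Q
  ⊢deductionForm-mp []         ⊢Q = ⊢Q
  ⊢deductionForm-mp (⊢P ∷ ⊢Ps) ⊢θ = ⊢deductionForm-mp ⊢Ps (⊢repeatImp-mp n ⊢P ⊢θ)

  skeleton : List Form → Form → LForm
  skeleton L (var i) = lvar (index L (var i))
  skeleton L (¬' φ)  = lneg (skeleton L φ)
  skeleton L (φ ⇒ ψ) = limp (skeleton L φ) (skeleton L ψ)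
  skeleton L (φ ≻ ψ) = lvar (index L (φ ≻ ψ))

  evalL-skeleton : ∀ L w φ → evalL n w (skeleton L φ) ≡ evalAtoms (λ a → w (index L a)) φ
  evalL-skeleton L w (var i) = refl
  evalL-skeleton L w (¬' φ)  rewrite evalL-skeleton L w φ = refl
  evalL-skeleton L w (φ ⇒ ψ) rewrite evalL-skeleton L w φ | evalL-skeleton L w ψ = refl
  evalL-skeleton L w (φ ≻ ψ) = refl

  inst-skeleton : ∀ L σ φ → (∀ {a} → a ∈ atoms φ → σ (index L a) ≡ a) → inst σ (skeleton L φ) ≡ φ
  inst-skeleton L σ (var i) h = h (here refl)
  inst-skeleton L σ (¬' φ)  h = cong ¬'_ (inst-skeleton L σ φ h)
  inst-skeleton L σ (φ ⇒ ψ) h = cong₂ _⇒_ (inst-skeleton L σ φ λ a∈ → h (∈-++⁺ˡ a∈))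
                                         (inst-skeleton L σ ψ λ a∈ → h (∈-++⁺ʳ (atoms φ) a∈))
  inst-skeleton L σ (φ ≻ ψ) h = h (here refl)

  -- The entailment becomes a tautology of L once its atoms are replaced by variables, which axL provides.
  ⊢-entailed : ∀ {Ps Q} → All ⊢_ Ps → Entails Ps Q → ⊢ Q
  ⊢-entailed {Ps} {Q} ⊢Ps Ps⊨Q = ⊢deductionForm-mp ⊢Ps (subst ⊢_ θ-instance (axL (skeleton L θ) taut σ))
    where
      θ : Form
      θ = deductionForm Ps Q
      L : List Form
      L = atoms θ
      σ : ℕ → Form
      σ = nth (var 0) L
      θ-instance : inst σ (skeleton L θ) ≡ θ
      θ-instance = inst-skeleton L σ θ (nth-index L)
      taut : Taut n (skeleton L θ)
      taut w w≤n = trans (evalL-skeleton L w θ)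
        (deductionForm-≡n (evalAtoms-isEvaluation (λ _ → w≤n _)) Ps Q (Ps⊨Q _ (λ _ → w≤n _)))

data Extension : Set where
  ext : ℕ → List Extension → Extension

mutual
  _≟ₑ_ : DecidableEquality Extension
  ext a xs ≟ₑ ext b ys = map′ (λ (p , q) → cong₂ ext p q) (λ { refl → refl , refl }) (a ℕ.≟ b ×-dec xs ≟ₑₛ ys)

  _≟ₑₛ_ : DecidableEquality (List Extension)
  []       ≟ₑₛ []       = yes refl
  []       ≟ₑₛ (_ ∷ _)  = no λ ()
  (_ ∷ _)  ≟ₑₛ []       = no λ ()
  (x ∷ xs) ≟ₑₛ (y ∷ ys) = map′ (λ (p , q) → cong₂ _∷_ p q) (λ { refl → refl , refl }) (x ≟ₑ y ×-dec xs ≟ₑₛ ys)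

-- A node carries a valuation of the variables and weighted edges (P , b , c). At the node, α ≻ β takes
-- the least value of b → β at c over the edges whose label P is the list of extensions of α at the children.
data Tree : Set where
  node : (ℕ → ℕ) → List (List Extension × ℕ × Tree) → Tree

Edge : Set
Edge = List Extension × ℕ × Tree

module TreeModels (n : ℕ) where
  open Łukasiewicz n

  guarded : {A : Set} → Dec A → ℕ → ℕ → ℕ
  guarded (yes _) b y = b ⇒ₗ y
  guarded (no _)  b y = n

  mutual
    ⟦_⟧ : Form → Tree → ℕ
    ⟦ var i ⟧ (node v es) = v i
    ⟦ ¬' φ ⟧  τ           = ¬ₗ ⟦ φ ⟧ τ
    ⟦ φ ⇒ ψ ⟧ τ           = ⟦ φ ⟧ τ ⇒ₗ ⟦ ψ ⟧ τ
    ⟦ α ≻ β ⟧ (node v es) = conditional es (extensions α es) β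

    conditional : List Edge → List Extension → Form → ℕ
    conditional []                 P β = n
    conditional ((p , b , c) ∷ es) P β = guarded (p ≟ₑₛ P) b (⟦ β ⟧ c) ⊓ conditional es P β

    extension : Form → Tree → Extension
    extension α (node v es) = ext (⟦ α ⟧ (node v es)) (extensions α es)

    extensions : Form → List Edge → List Extension
    extensions α []                 = []
    extensions α ((p , b , c) ∷ es) = extension α c ∷ extensions α es

  mutual
    WellFormed : Tree → Set
    WellFormed (node v es) = (∀ i → v i ≤ n) × WellFormedEdges es

    WellFormedEdges : List Edge → Set
    WellFormedEdges []                 = ⊤
    WellFormedEdges ((p , b , c) ∷ es) = b ≤ n × WellFormed c × WellFormedEdges es

  Valid : Form → Set
  Valid φ = ∀ τ → WellFormed τ → ⟦ φ ⟧ τ ≡ n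

  guarded-≤ : ∀ {A} (d : Dec A) b y → guarded d b y ≤ n
  guarded-≤ (yes _) b y = m∸n≤m n (b ∸ y)
  guarded-≤ (no _)  b y = ≤-refl

  conditional-≤ : ∀ es P β → conditional es P β ≤ n
  conditional-≤ []                 P β = ≤-refl
  conditional-≤ ((p , b , c) ∷ es) P β = ≤-trans (m⊓n≤n _ _) (conditional-≤ es P β)

  ⟦⟧-≤ : ∀ φ τ → WellFormed τ → ⟦ φ ⟧ τ ≤ n
  ⟦⟧-≤ (var i) (node v es) (v≤n , _) = v≤n i
  ⟦⟧-≤ (¬' φ)  τ           _         = m∸n≤m n (⟦ φ ⟧ τ)
  ⟦⟧-≤ (φ ⇒ ψ) τ           _         = m∸n≤m n (⟦ φ ⟧ τ ∸ ⟦ ψ ⟧ τ)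
  ⟦⟧-≤ (α ≻ β) (node v es) _         = conditional-≤ es _ β

  ⟦⟧-isEvaluation : ∀ τ → WellFormed τ → IsEvaluation n (λ φ → ⟦ φ ⟧ τ)
  ⟦⟧-isEvaluation τ wf = record { eval-¬ = λ _ → refl ; eval-⇒ = λ _ _ → refl ; eval-≤ = λ φ → ⟦⟧-≤ φ τ wf }

  extension-≡⇒⟦⟧-≡ : ∀ {α α′} τ → extension α τ ≡ extension α′ τ → ⟦ α ⟧ τ ≡ ⟦ α′ ⟧ τ
  extension-≡⇒⟦⟧-≡ (node v es) = cong λ { (ext a _) → a }

  conditional-≥ : ∀ {c} es P β → c ≤ n → All (λ { (p , b , τ) → p ≡ P → c ≤ b ⇒ₗ ⟦ β ⟧ τ }) es →
                  c ≤ conditional es P β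
  conditional-≥ []                 P β c≤n []       = c≤n
  conditional-≥ {c} ((p , b , τ) ∷ es) P β c≤n (h ∷ hs) = ⊓-glb (at-edge (p ≟ₑₛ P)) (conditional-≥ es P β c≤n hs)
    where
      at-edge : (d : Dec (p ≡ P)) → c ≤ guarded d b (⟦ β ⟧ τ)
      at-edge (yes p≡P) = h p≡P
      at-edge (no _)    = c≤n

  conditional-≤-edge : ∀ es P β {b τ} → (P , b , τ) ∈ es → conditional es P β ≤ b ⇒ₗ ⟦ β ⟧ τ
  conditional-≤-edge ((P , b , τ) ∷ es) P β (here refl) = ≤-trans (m⊓n≤m _ _) (at-edge (P ≟ₑₛ P))
    where
      at-edge : (d : Dec (P ≡ P)) → guarded d b (⟦ β ⟧ τ) ≤ b ⇒ₗ ⟦ β ⟧ τ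
      at-edge (yes _) = ≤-refl
      at-edge (no P≢P) = contradiction refl P≢P
  conditional-≤-edge (_ ∷ es) P β (there e∈) = ≤-trans (m⊓n≤n _ _) (conditional-≤-edge es P β e∈)

  module _ {φ ψ : Form} (φ⇔ψ : Valid (φ ⇔ ψ)) where

    ⇔-valid⇒⟦⟧-≡ : ∀ τ → WellFormed τ → ⟦ φ ⟧ τ ≡ ⟦ ψ ⟧ τ
    ⇔-valid⇒⟦⟧-≡ τ wf = EvaluationProperties.⇔-≡n⇒≡ (⟦⟧-isEvaluation τ wf) φ ψ (φ⇔ψ τ wf)

    mutual
      ⇔-valid⇒extension-≡ : ∀ τ → WellFormed τ → extension φ τ ≡ extension ψ τ
      ⇔-valid⇒extension-≡ (node v es) wf@(_ , wfs) =
        cong₂ ext (⇔-valid⇒⟦⟧-≡ (node v es) wf) (⇔-valid⇒extensions-≡ es wfs)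

      ⇔-valid⇒extensions-≡ : ∀ es → WellFormedEdges es → extensions φ es ≡ extensions ψ es
      ⇔-valid⇒extensions-≡ []                 _              = refl
      ⇔-valid⇒extensions-≡ ((p , b , c) ∷ es) (_ , wfc , wfs) =
        cong₂ _∷_ (⇔-valid⇒extension-≡ c wfc) (⇔-valid⇒extensions-≡ es wfs)

    ⇔-valid⇒conditional-≡ : ∀ es P → WellFormedEdges es → conditional es P φ ≡ conditional es P ψ
    ⇔-valid⇒conditional-≡ []                 P _               = refl
    ⇔-valid⇒conditional-≡ ((p , b , c) ∷ es) P (_ , wfc , wfs)
      rewrite ⇔-valid⇒⟦⟧-≡ c wfc | ⇔-valid⇒conditional-≡ es P wfs = refl

  conditional-∧ : ∀ φ ψ es P → WellFormedEdges es →
                  conditional es P (φ ∧' ψ) ≡ conditional es P φ ⊓ conditional es P ψ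
  conditional-∧ φ ψ []                 P _ = sym (⊓-idem n)
  conditional-∧ φ ψ ((p , b , c) ∷ es) P (_ , wfc , wfs)
    rewrite conditional-∧ φ ψ es P wfs | EvaluationProperties.∧-≡⊓ (⟦⟧-isEvaluation c wfc) φ ψ =
    trans (cong (_⊓ (conditional es P φ ⊓ conditional es P ψ)) (guarded-⊓ (p ≟ₑₛ P)))
          (interchange (guarded (p ≟ₑₛ P) b (⟦ φ ⟧ c)) (guarded (p ≟ₑₛ P) b (⟦ ψ ⟧ c)) _ _)
    where
      guarded-⊓ : ∀ {A} (d : Dec A) → guarded d b (⟦ φ ⟧ c ⊓ ⟦ ψ ⟧ c) ≡ guarded d b (⟦ φ ⟧ c) ⊓ guarded d b (⟦ ψ ⟧ c)
      guarded-⊓ (yes _) rewrite ∸-distribˡ-⊓-⊔ b (⟦ φ ⟧ c) (⟦ ψ ⟧ c) = ∸-distribˡ-⊔-⊓ n (b ∸ ⟦ φ ⟧ c) (b ∸ ⟦ ψ ⟧ c)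
      guarded-⊓ (no _)  = sym (⊓-idem n)

  conditional-t : ∀ es P → WellFormedEdges es → conditional es P t ≡ n
  conditional-t []                 P _ = refl
  conditional-t ((p , b , c) ∷ es) P (b≤n , wfc , wfs) rewrite conditional-t es P wfs =
    trans (m≤n⇒m⊓n≡m (guarded-≤ (p ≟ₑₛ P) b _)) (guarded-t (p ≟ₑₛ P))
    where
      guarded-t : ∀ {A} (d : Dec A) → guarded d b (⟦ t ⟧ c) ≡ n
      guarded-t (yes _) rewrite EvaluationProperties.t-≡n (⟦⟧-isEvaluation c wfc) | m≤n⇒m∸n≡0 b≤n = refl
      guarded-t (no _)  = refl

module Soundness (n : ℕ) (n≢0 : n ≢ 0) (J : ℕ → LForm) (isJ : IsJ n J) where
  open Łukasiewicz n
  open Ops n J hiding (_⊙_)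
  open RaSchema n J
  open Consequence n J using (⊢_)
  open TreeModels n

  module AtNode (τ : Tree) (wf : WellFormed τ) where
    open EvaluationProperties (⟦⟧-isEvaluation τ wf) public
    open ThresholdProperties J (⟦⟧-isEvaluation τ wf) public
    open Exact n≢0 isJ public

  conditional-Ra : ∀ {a} γs γ → a ≤ n → (∀ b → b ≤ n → Valid (RaPremise a γs γ b)) →
                   ∀ es P → WellFormedEdges es →
                   AllUpTo (suc n) (λ i → aᵢ i ≤ conditional es P (γs i)) → a ≤ conditional es P γ
  conditional-Ra γs γ a≤n premises []                 P _                 _  = a≤n
  conditional-Ra {a} γs γ a≤n premises ((p , b , c) ∷ es) P (b≤n , wfc , wfs) hs =
    ⊓-glb (at-edge (p ≟ₑₛ P) λ i 1≤i i≤ → ≤-trans (hs i 1≤i i≤) (m⊓n≤m _ _))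
          (conditional-Ra γs γ a≤n premises es P wfs λ i 1≤i i≤ → ≤-trans (hs i 1≤i i≤) (m⊓n≤n _ _))
    where
      at-edge : ∀ {A} (d : Dec A) → AllUpTo (suc n) (λ i → aᵢ i ≤ guarded d b (⟦ γs i ⟧ c)) →
                a ≤ guarded d b (⟦ γ ⟧ c)
      at-edge (no _)  _  = a≤n
      at-edge (yes _) hs = AtNode.RaPremise-≡n⇒ c wfc γs γ a≤n b≤n (premises b b≤n c wfc) hs

  sound : ∀ {φ} → ⊢ φ → Valid φ
  sound (axL ψ taut σ) τ wf = trans (inst-≡evalL σ ψ) (taut _ λ i → ⟦⟧-≤ (σ i) τ wf)
    where open AtNode τ wf
  sound (mp {φ} {ψ} ⊢φ ⊢φ⇒ψ) τ wf = mp-≡n φ ψ (sound ⊢φ τ wf) (sound ⊢φ⇒ψ τ wf)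
    where open AtNode τ wf
  sound (A1 φ ψ θ) τ@(node v es) wf@(_ , wfs) = ≤⇒⇒-≡n (φ ≻ (ψ ∧' θ)) ((φ ≻ ψ) ∧' (φ ≻ θ))
    (≤-reflexive (trans (conditional-∧ ψ θ es _ wfs) (sym (∧-≡⊓ (φ ≻ ψ) (φ ≻ θ)))))
    where open AtNode τ wf
  sound (A2 φ ψ θ) τ@(node v es) wf@(_ , wfs) = ≤⇒⇒-≡n ((φ ≻ ψ) ∧' (φ ≻ θ)) (φ ≻ (ψ ∧' θ))
    (≤-reflexive (trans (∧-≡⊓ (φ ≻ ψ) (φ ≻ θ)) (sym (conditional-∧ ψ θ es _ wfs))))
    where open AtNode τ wf
  sound (A3 φ) (node v es) (_ , wfs) = conditional-t es _ wfs
  sound (RCEA {φ} {ψ} θ ⊢φ⇔ψ) τ@(node v es) wf@(_ , wfs) = ≡⇒⇔-≡n (φ ≻ θ) (ψ ≻ θ)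
    (cong (λ P → conditional es P θ) (⇔-valid⇒extensions-≡ (sound ⊢φ⇔ψ) es wfs))
    where open AtNode τ wf
  sound (RCEC {φ} {ψ} θ ⊢φ⇔ψ) τ@(node v es) wf@(_ , wfs) = ≡⇒⇔-≡n (θ ≻ φ) (θ ≻ ψ)
    (⇔-valid⇒conditional-≡ (sound ⊢φ⇔ψ) es _ wfs)
    where open AtNode τ wf
  sound (Ra a a≤n φ γs γ ⊢premises) τ@(node v es) wf@(_ , wfs) =
    itImp-intro (suc n) _ _ (λ i 1≤i _ → If-crisp (aᵢ i) (φ ≻ γs i) (aᵢ≤n i 1≤i)) λ hs →
      If-≡n a (φ ≻ γ) a≤n (conditional-Ra γs γ a≤n (λ b b≤n → sound (⊢premises b b≤n)) es _ wfs
        λ i 1≤i i≤ → If-≡n⇒≤ (aᵢ i) (φ ≻ γs i) (aᵢ≤n i 1≤i) (hs i 1≤i i≤))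
    where open AtNode τ wf

module DerivedRules (n : ℕ) (J : ℕ → LForm) where
  open AtomValuations n
  open Consequence n J

  ⊢⇔-sym : ∀ {φ ψ} → ⊢ (φ ⇔ ψ) → ⊢ (ψ ⇔ φ)
  ⊢⇔-sym {φ} {ψ} ⊢φ⇔ψ = ⊢-entailed (⊢φ⇔ψ ∷ []) λ { V bV (φ⇔ψ ∷ []) →
    let open EvaluationProperties (evalAtoms-isEvaluation bV) in ≡⇒⇔-≡n ψ φ (sym (⇔-≡n⇒≡ φ ψ φ⇔ψ)) }

  -- A1, A2 and A3 make α ≻ _ commute with conjunction; RCEA then replaces each antecedent by α.
  ⊢≻⋀⇔⋀≻ : ∀ α ps → All (λ p → ⊢ (proj₁ p ⇔ α)) ps →
           ⊢ ((α ≻ ⋀ (map proj₂ ps)) ⇔ ⋀ (map (uncurry _≻_) ps))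
  ⊢≻⋀⇔⋀≻ α [] [] = ⊢-entailed (A3 α ∷ []) λ { V bV (α≻t ∷ []) →
    let open EvaluationProperties (evalAtoms-isEvaluation bV) in ≡⇒⇔-≡n (α ≻ t) t (trans α≻t (sym t-≡n)) }
  ⊢≻⋀⇔⋀≻ α ((α′ , β) ∷ ps) (⊢α′⇔α ∷ ⊢ps) =
    ⊢-entailed (A1 α β B ∷ A2 α β B ∷ RCEA β (⊢⇔-sym ⊢α′⇔α) ∷ ⊢≻⋀⇔⋀≻ α ps ⊢ps ∷ [])
      λ { V bV (a1 ∷ a2 ∷ rcea ∷ ih ∷ []) →
        let open EvaluationProperties (evalAtoms-isEvaluation bV)
            e = evalAtoms V
        in ≡⇒⇔-≡n (α ≻ (β ∧' B)) ((α′ ≻ β) ∧' C) (begin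
             e (α ≻ (β ∧' B))             ≡⟨ ⇒-≡n-both⇒≡ (α ≻ (β ∧' B)) ((α ≻ β) ∧' (α ≻ B)) a1 a2 ⟩
             e ((α ≻ β) ∧' (α ≻ B))       ≡⟨ ∧-≡⊓ (α ≻ β) (α ≻ B) ⟩
             e (α ≻ β) ⊓ e (α ≻ B)        ≡⟨ cong₂ _⊓_ (⇔-≡n⇒≡ (α ≻ β) (α′ ≻ β) rcea) (⇔-≡n⇒≡ (α ≻ B) C ih) ⟩
             e (α′ ≻ β) ⊓ e C             ≡⟨ ∧-≡⊓ (α′ ≻ β) C ⟨
             e ((α′ ≻ β) ∧' C)            ∎) }
    where
      open ≡-Reasoning
      B C : Form
      B = ⋀ (map proj₂ ps)
      C = ⋀ (map (uncurry _≻_) ps)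

depth : Form → ℕ
depth (var i) = 0
depth (¬' φ)  = depth φ
depth (φ ⇒ ψ) = depth φ ⊔ depth ψ
depth (φ ≻ ψ) = suc (depth φ ⊔ depth ψ)

module DepthBounds (n : ℕ) (J : ℕ → LForm) (D : ℕ) where
  open Ops n J

  Shallow : Form → Set
  Shallow φ = depth φ < D

  ⇒-shallow : ∀ φ ψ → Shallow φ → Shallow ψ → Shallow (φ ⇒ ψ)
  ⇒-shallow φ ψ = ⊔-lub

  ∧-shallow : ∀ φ ψ → Shallow φ → Shallow ψ → Shallow (φ ∧' ψ)
  ∧-shallow φ ψ φ< ψ< = ⇒-shallow ((¬' φ) ⇒ (¬' ψ)) (¬' ψ) (⇒-shallow (¬' φ) (¬' ψ) φ< ψ<) ψ<

  ⇔-shallow : ∀ φ ψ → Shallow φ → Shallow ψ → Shallow (φ ⇔ ψ)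
  ⇔-shallow φ ψ φ< ψ< = ∧-shallow (φ ⇒ ψ) (ψ ⇒ φ) (⇒-shallow φ ψ φ< ψ<) (⇒-shallow ψ φ ψ< φ<)

  inst-shallow : ∀ φ ψ → Shallow φ → Shallow (inst (λ _ → φ) ψ)
  inst-shallow φ (lvar i)   φ< = φ<
  inst-shallow φ (lneg ψ)   φ< = inst-shallow φ ψ φ<
  inst-shallow φ (limp ψ χ) φ< = ⇒-shallow (inst _ ψ) (inst _ χ) (inst-shallow φ ψ φ<) (inst-shallow φ χ φ<)

  Iaux-shallow : ∀ c k φ → Shallow φ → Shallow (Iaux c k φ)
  Iaux-shallow zero    k φ φ< = inst-shallow φ (J k) φ<
  Iaux-shallow (suc c) k φ φ< = ⇒-shallow (Jf k φ ⇒ I) I (⇒-shallow (Jf k φ) I J< I<) I<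
    where
      I : Form
      I = Iaux c (suc k) φ
      J< : Shallow (Jf k φ)
      J< = inst-shallow φ (J k) φ<
      I< : Shallow I
      I< = Iaux-shallow c (suc k) φ φ<

  If-shallow : ∀ k φ → Shallow φ → Shallow (If k φ)
  If-shallow k = Iaux-shallow (n ∸ k) k

  itImp-shallow : ∀ k f ψ → AllUpTo k (λ i → Shallow (f i)) → Shallow ψ → Shallow (itImp k f ψ)
  itImp-shallow zero    f ψ _  ψ< = ψ<
  itImp-shallow (suc k) f ψ hs ψ< =
    ⇒-shallow (f (suc k)) (itImp k f ψ) (AllUpTo-last hs) (itImp-shallow k f ψ (AllUpTo-init hs) ψ<)

  ⋀-shallow : ∀ φs → 0 < D → All Shallow φs → Shallow (⋀ φs)
  ⋀-shallow []       0<D []         = 0<D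
  ⋀-shallow (φ ∷ φs) 0<D (φ< ∷ φs<) = ∧-shallow φ (⋀ φs) φ< (⋀-shallow φs 0<D φs<)

conditionals : Form → List (Form × Form)
conditionals (var i) = []
conditionals (¬' φ)  = conditionals φ
conditionals (φ ⇒ ψ) = conditionals φ ++ conditionals ψ
conditionals (φ ≻ ψ) = (φ , ψ) ∷ []

conditionals-depth : ∀ φ {α β} → (α , β) ∈ conditionals φ → suc (depth α ⊔ depth β) ≤ depth φ
conditionals-depth (¬' φ)  p∈ = conditionals-depth φ p∈
conditionals-depth (φ ⇒ ψ) p∈ with ∈-++⁻ (conditionals φ) p∈
... | inj₁ p∈φ = ≤-trans (conditionals-depth φ p∈φ) (m≤m⊔n (depth φ) (depth ψ))
... | inj₂ p∈ψ = ≤-trans (conditionals-depth ψ p∈ψ) (m≤n⊔m (depth φ) (depth ψ))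
conditionals-depth (φ ≻ ψ) (here refl) = ≤-refl

atoms-conditionals : ∀ φ {a} → a ∈ atoms φ →
                     (∃[ i ] a ≡ var i) ⊎ (∃[ p ] p ∈ conditionals φ × a ≡ uncurry _≻_ p)
atoms-conditionals (var i) (here refl) = inj₁ (i , refl)
atoms-conditionals (¬' φ)  a∈ = atoms-conditionals φ a∈
atoms-conditionals (φ ⇒ ψ) a∈ with ∈-++⁻ (atoms φ) a∈
... | inj₁ a∈φ = Sum.map₂ (λ (p , p∈ , eq) → p , ∈-++⁺ˡ p∈ , eq) (atoms-conditionals φ a∈φ)
... | inj₂ a∈ψ = Sum.map₂ (λ (p , p∈ , eq) → p , ∈-++⁺ʳ (conditionals φ) p∈ , eq) (atoms-conditionals ψ a∈ψ)
atoms-conditionals (φ ≻ ψ) (here refl) = inj₂ ((φ , ψ) , here refl , refl)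

∈-graph⁻ : {A : Set} {f : A → ℕ} {x : A} {c : ℕ} (xs : List A) → (x , c) ∈ graph f xs → x ∈ xs × c ≡ f x
∈-graph⁻ xs xc∈ with _ , x∈ , refl ← ∈-map⁻ _ xc∈ = x∈ , refl

map-≡⇒≡ : {A B : Set} (f h : A → B) {x : A} (xs : List A) → map f xs ≡ map h xs → x ∈ xs → f x ≡ h x
map-≡⇒≡ f h (y ∷ xs) eq (here refl) = proj₁ (∷-injective eq)
map-≡⇒≡ f h (y ∷ xs) eq (there x∈)  = map-≡⇒≡ f h xs (proj₂ (∷-injective eq)) x∈

module Completeness (n : ℕ) (n≢0 : n ≢ 0) (J : ℕ → LForm) (isJ : IsJ n J) where
  open Łukasiewicz n
  open Ops n J hiding (_⊙_)
  open RaSchema n J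
  open AtomValuations n
  open Consequence n J
  open DerivedRules n J
  open TreeModels n
  open Soundness n n≢0 J isJ

  CounterModel : Form → Set
  CounterModel ψ = Σ Tree λ τ → WellFormed τ × ⟦ ψ ⟧ τ ≢ n

  Decided : Form → Set
  Decided ψ = ⊢ ψ ⊎ CounterModel ψ

  Profile : Set
  Profile = List ((Form × Form) × ℕ)

  module Step (χ : Form) (ih : ∀ ψ → depth ψ < depth χ → Decided ψ) where
    open DepthBounds n J (depth χ)

    S : List (Form × Form)
    S = conditionals χ

    antecedent-shallow : ∀ {α β} → (α , β) ∈ S → Shallow α
    antecedent-shallow p∈ = ≤-trans (s≤s (m≤m⊔n _ _)) (conditionals-depth χ p∈)

    consequent-shallow : ∀ {α β} → (α , β) ∈ S → Shallow β
    consequent-shallow p∈ = ≤-trans (s≤s (m≤n⊔m _ _)) (conditionals-depth χ p∈)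

    ShallowTheorem : Form → Set
    ShallowTheorem ψ = Shallow ψ × ⊢ ψ

    shallowTheorem? : ∀ ψ → Dec (ShallowTheorem ψ)
    shallowTheorem? ψ with depth ψ <? depth χ
    ... | no ¬s = no (¬s ∘ proj₁)
    ... | yes s with ih ψ s
    ...   | inj₁ ⊢ψ             = yes (s , ⊢ψ)
    ...   | inj₂ (τ , wf , ψ≢n) = no λ (_ , ⊢ψ) → ψ≢n (sound ⊢ψ τ wf)

    refutations : (ψ : Form) → List (CounterModel ψ)
    refutations ψ with depth ψ <? depth χ
    ... | no _ = []
    ... | yes s with ih ψ s
    ...   | inj₁ _  = []
    ...   | inj₂ cm = cm ∷ []

    refutation-exists : ∀ ψ → Shallow ψ → ¬ ⊢ ψ → ∃[ cm ] cm ∈ refutations ψ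
    refutation-exists ψ s ¬⊢ψ with depth ψ <? depth χ
    ... | no ¬s = contradiction s ¬s
    ... | yes s′ with ih ψ s′
    ...   | inj₁ ⊢ψ = contradiction ⊢ψ ¬⊢ψ
    ...   | inj₂ cm = cm , here refl

    Equivalent : Form → Form → Set
    Equivalent α α′ = ShallowTheorem (α ⇔ α′)

    Selects : Form → ℕ → (Form × Form) × ℕ → Set
    Selects α′ m ((α , _) , c) = Equivalent α α′ × m ≤ c

    selects? : ∀ α′ m → Decidable (Selects α′ m)
    selects? α′ m ((α , _) , c) = shallowTheorem? (α ⇔ α′) ×-dec m ≤? c

    selected : Form → ℕ → Profile → List (Form × Form)
    selected α′ m zs = map proj₁ (filter (selects? α′ m) zs)

    ∈-selected⁻ : ∀ {α′ m zs p} → p ∈ selected α′ m zs → ∃[ c ] (p , c) ∈ zs × Selects α′ m (p , c)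
    ∈-selected⁻ {α′} {m} p∈ with (p , c) , pc∈ , refl ← ∈-map⁻ proj₁ p∈ = c , ∈-filter⁻ (selects? α′ m) pc∈

    ∈-selected⁺ : ∀ {α′ m zs p c} → (p , c) ∈ zs → Selects α′ m (p , c) → p ∈ selected α′ m zs
    ∈-selected⁺ {α′} {m} pc∈ sel = ∈-map⁺ proj₁ (∈-filter⁺ (selects? α′ m) pc∈ sel)

    selected-equivalent : ∀ {α′ m zs p} → p ∈ selected α′ m zs → ⊢ (proj₁ p ⇔ α′)
    selected-equivalent {α′} {m} {zs} p∈ with _ , _ , ((_ , ⊢α⇔α′) , _) ← ∈-selected⁻ {α′} {m} {zs} p∈ = ⊢α⇔α′

    consequents : Form → Profile → ℕ → Form
    consequents α′ zs i = ⋀ (map proj₂ (selected α′ (aᵢ i) zs))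

    selectedConditionals : Form → Profile → ℕ → Form
    selectedConditionals α′ zs i = ⋀ (map (uncurry _≻_) (selected α′ (aᵢ i) zs))

    -- The conclusion of R_a for γ_i := consequents α′ zs i, with α′ ≻ γ_i replaced (via ⊢≻⋀⇔⋀≻) by
    -- a conjunction of conditionals of the profile.
    RaFact : Form → Form → ℕ → Profile → Form
    RaFact α′ γ a zs = itImp (suc n) (λ i → If (aᵢ i) (selectedConditionals α′ zs i)) (If a (α′ ≻ γ))

    ⊢RaFact : ∀ α′ γ {a} zs → a ≤ n → (∀ b → b ≤ n → ⊢ RaPremise a (consequents α′ zs) γ b) →
              ⊢ RaFact α′ γ a zs
    ⊢RaFact α′ γ {a} zs a≤n ⊢premises =
      ⊢-entailed (Ra a a≤n α′ (consequents α′ zs) γ ⊢premises ∷ ⊢links (suc n)) entailed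
      where
        conclusion : Form
        conclusion = itImp (suc n) (λ i → If (aᵢ i) (α′ ≻ consequents α′ zs i)) (If a (α′ ≻ γ))

        link : ℕ → Form
        link i = (α′ ≻ consequents α′ zs i) ⇔ selectedConditionals α′ zs i

        links : ℕ → List Form
        links zero    = []
        links (suc k) = link (suc k) ∷ links k

        ⊢links : ∀ k → All ⊢_ (links k)
        ⊢links zero    = []
        ⊢links (suc k) = ⊢≻⋀⇔⋀≻ α′ (selected α′ (aᵢ (suc k)) zs)
                           (All.tabulate (selected-equivalent {α′} {aᵢ (suc k)} {zs})) ∷ ⊢links k

        links-hold : ∀ {V} k → All (Holds V) (links k) → AllUpTo k (Holds V ∘ link)
        links-hold zero    []       = AllUpTo-zero
        links-hold (suc k) (h ∷ hs) = AllUpTo-snoc (links-hold k hs) h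

        entailed : Entails (conclusion ∷ links (suc n)) (RaFact α′ γ a zs)
        entailed V bV (hRa ∷ hlinks) = trans (sym (itImp-cong (suc n) _ _ _ _ same-hypotheses refl)) hRa
          where
            isEval : IsEvaluation n (evalAtoms V)
            isEval = evalAtoms-isEvaluation bV
            open EvaluationProperties isEval using (⇔-≡n⇒≡)
            open ThresholdProperties J isEval using (itImp-cong; If-cong)
            same-hypotheses : AllUpTo (suc n) λ i → evalAtoms V (If (aᵢ i) (α′ ≻ consequents α′ zs i))
                                                  ≡ evalAtoms V (If (aᵢ i) (selectedConditionals α′ zs i))
            same-hypotheses i 1≤i i≤ =
              If-cong (aᵢ i) _ _ (⇔-≡n⇒≡ (α′ ≻ consequents α′ zs i) (selectedConditionals α′ zs i)
                                          (links-hold (suc n) hlinks i 1≤i i≤))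

    Fact : Set
    Fact = Σ Form ⊢_

    RaPremisesShallowTheorems : Form → Form → ℕ → Profile → Set
    RaPremisesShallowTheorems α′ γ a zs = All (λ b → ShallowTheorem (RaPremise a (consequents α′ zs) γ b)) (upTo (suc n))

    RaPremisesShallowTheorems? : ∀ α′ γ a zs → Dec (RaPremisesShallowTheorems α′ γ a zs)
    RaPremisesShallowTheorems? α′ γ a zs = All.all? (λ b → shallowTheorem? (RaPremise a (consequents α′ zs) γ b)) (upTo (suc n))

    factsFor : Form × Form → ℕ → Profile → List Fact
    factsFor (α′ , γ) a zs with a ≤? n | RaPremisesShallowTheorems? α′ γ a zs
    ... | yes a≤n | yes premises = (RaFact α′ γ a zs , ⊢RaFact α′ γ zs a≤n λ b b≤n →
                                      proj₂ (All.lookup premises (∈-upTo⁺ (s≤s b≤n)))) ∷ []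
    ... | _       | _            = []

    -- Finitely many candidate instances of R_a: one per conditional of χ, value a and profile of values for
    -- the conditionals of χ. The induction hypothesis decides which of them have (shallow) theorems as premises.
    facts : List Fact
    facts = concatMap (λ p → concatMap (λ a → concatMap (factsFor p a) (profiles S)) (upTo (suc n))) S

    Fs : List Form
    Fs = map proj₁ facts

    RaFact∈factsFor : ∀ {α′ γ a zs} → a ≤ n → RaPremisesShallowTheorems α′ γ a zs →
                      RaFact α′ γ a zs ∈ map proj₁ (factsFor (α′ , γ) a zs)
    RaFact∈factsFor {α′} {γ} {a} {zs} a≤n premises
      with a ≤? n | RaPremisesShallowTheorems? α′ γ a zs
    ... | yes _   | yes _        = here refl
    ... | no a≰n  | _            = contradiction a≤n a≰n
    ... | yes _   | no ¬premises = contradiction premises ¬premises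

    RaFact∈Fs : ∀ {α′ γ a zs} → (α′ , γ) ∈ S → a ≤ n → zs ∈ profiles S →
                RaPremisesShallowTheorems α′ γ a zs → RaFact α′ γ a zs ∈ Fs
    RaFact∈Fs {a = a} p∈ a≤n zs∈ premises with fact , fact∈ , refl ← ∈-map⁻ proj₁ (RaFact∈factsFor a≤n premises)
      = ∈-map⁺ proj₁ (∈-concatMap⁺′ _ p∈ (∈-concatMap⁺′ _ (∈-upTo⁺ (s≤s a≤n)) (∈-concatMap⁺′ (factsFor _ a) zs∈ fact∈)))

    module CounterModelFrom (V : Form → ℕ) (V-refutes : Refutes V Fs χ) where
      bV : Bounded V
      bV = proj₁ V-refutes

      g : Form × Form → ℕ
      g = V ∘ uncurry _≻_

      zsV : Profile
      zsV = graph g S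

      selected-≥ : ∀ {α′ m p} → p ∈ selected α′ m zsV → m ≤ g p
      selected-≥ p∈ with c , pc∈ , (_ , m≤c) ← ∈-selected⁻ p∈ with _ , refl ← ∈-graph⁻ S pc∈ = m≤c

      selected-⊆S : ∀ {α′ m p} → p ∈ selected α′ m zsV → p ∈ S
      selected-⊆S p∈ with c , pc∈ , _ ← ∈-selected⁻ p∈ = proj₁ (∈-graph⁻ S pc∈)

      RaFact-sound : ∀ α′ γ {a} → a ≤ n → Holds V (RaFact α′ γ a zsV) → a ≤ g (α′ , γ)
      RaFact-sound α′ γ {a} a≤n holds = If-≡n⇒≤ a (α′ ≻ γ) a≤n (itImp-elim (suc n) _ _ holds
        λ i 1≤i _ → If-≡n (aᵢ i) _ (aᵢ≤n i 1≤i)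
          (⋀-glb (map (uncurry _≻_) (selected α′ (aᵢ i) zsV)) (aᵢ≤n i 1≤i)
            (map⁺ (All.tabulate λ p∈ → selected-≥ {α′} {aᵢ i} p∈))))
        where
          isEval : IsEvaluation n (evalAtoms V)
          isEval = evalAtoms-isEvaluation bV
          open EvaluationProperties isEval using (⋀-glb)
          open ThresholdProperties J isEval using (itImp-elim)
          open ThresholdProperties.Exact J isEval n≢0 isJ using (If-≡n; If-≡n⇒≤)

      witnessPremise : Form → Form → ℕ → Form
      witnessPremise α′ γ b = RaPremise (suc (g (α′ , γ))) (consequents α′ zsV) γ b

      witnessPremise-shallow : ∀ {α′ γ} → (α′ , γ) ∈ S → ∀ b → Shallow (witnessPremise α′ γ b)
      witnessPremise-shallow {α′} {γ} p∈ b = itImp-shallow (suc n) _ _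
        (λ i _ _ → If-shallow (aᵢ i ⊙ b) (consequents α′ zsV i)
                     (⋀-shallow (map proj₂ (selected α′ (aᵢ i) zsV)) 0<D
                       (map⁺ (All.tabulate λ q∈ → consequent-shallow (selected-⊆S {α′} {aᵢ i} q∈)))))
        (If-shallow (suc (g (α′ , γ)) ⊙ b) γ (consequent-shallow p∈))
        where
          0<D : 0 < depth χ
          0<D = ≤-trans (s≤s z≤n) (conditionals-depth χ p∈)

      antecedents : List Form
      antecedents = map proj₁ S

      -- Weight-0 edges whose children tell apart antecedents that are not provably equivalent.
      separatorsFor : Form → Form → List (Form × ℕ × Tree)
      separatorsFor α α′ = map (λ cm → α , 0 , proj₁ cm) (refutations (α ⇔ α′))

      separators : List (Form × ℕ × Tree)
      separators = concatMap (λ α → concatMap (separatorsFor α) antecedents) antecedents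

      -- Edges whose children refute a premise of R_a for a := g (α′ , γ) + 1, pulling α′ ≻ γ down to g (α′ , γ).
      witnessesAt : Form → Form → ℕ → List (Form × ℕ × Tree)
      witnessesAt α′ γ b = map (λ cm → α′ , b , proj₁ cm) (refutations (witnessPremise α′ γ b))

      witnessesFor : Form × Form → List (Form × ℕ × Tree)
      witnessesFor (α′ , γ) with g (α′ , γ) <? n
      ... | no _  = []
      ... | yes _ = concatMap (witnessesAt α′ γ) (upTo (suc n))

      witnesses : List (Form × ℕ × Tree)
      witnesses = concatMap witnessesFor S

      anchored : List (Form × ℕ × Tree)
      anchored = separators ++ witnesses

      label : Form → List Extension
      label α = map (λ x → extension α (proj₂ (proj₂ x))) anchored

      relabel : List (Form × ℕ × Tree) → List Edge
      relabel = map λ (α′ , b , τ) → label α′ , b , τ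

      root : Tree
      root = node (V ∘ var) (relabel anchored)

      extensions-relabel : ∀ α xs → extensions α (relabel xs) ≡ map (λ x → extension α (proj₂ (proj₂ x))) xs
      extensions-relabel α []       = refl
      extensions-relabel α (x ∷ xs) = cong (_ ∷_) (extensions-relabel α xs)

      ⟦≻⟧root≡ : ∀ α β → ⟦ α ≻ β ⟧ root ≡ conditional (relabel anchored) (label α) β
      ⟦≻⟧root≡ α β = cong (λ P → conditional (relabel anchored) P β) (extensions-relabel α anchored)

      SeparatorEdge : Form × ℕ × Tree → Set
      SeparatorEdge (_ , b , τ) = b ≡ 0 × WellFormed τ

      WitnessEdge : Form × ℕ × Tree → Set
      WitnessEdge (α′ , b , τ) = Σ Form λ γ → (α′ , γ) ∈ S × g (α′ , γ) < n × b ≤ n × WellFormed τ ×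
                                   ⟦ witnessPremise α′ γ b ⟧ τ ≢ n

      separators-valid : All SeparatorEdge separators
      separators-valid = All-concatMap⁺ (λ α → concatMap (separatorsFor α) antecedents) {antecedents} λ {α} _ →
        All-concatMap⁺ (separatorsFor α) {antecedents} λ _ → map⁺ (All.universal (λ cm → refl , proj₁ (proj₂ cm)) _)

      witnessesFor-valid : ∀ {α′ γ} → (α′ , γ) ∈ S → All WitnessEdge (witnessesFor (α′ , γ))
      witnessesFor-valid {α′} {γ} p∈ with g (α′ , γ) <? n
      ... | no _    = []
      ... | yes g<n = All-concatMap⁺ (witnessesAt α′ γ) λ b∈ →
        map⁺ (All.universal (λ (τ , wf , refuted) → γ , p∈ , g<n , ≤-pred (∈-upTo⁻ b∈) , wf , refuted) _)

      witnesses-valid : All WitnessEdge witnesses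
      witnesses-valid = All-concatMap⁺ witnessesFor λ {p} p∈ → witnessesFor-valid p∈

      root-wellFormed : WellFormed root
      root-wellFormed = (λ i → bV (var i)) , relabel-wellFormed anchored
        (++⁺ (All.map (λ (b≡0 , wf) → subst (_≤ n) (sym b≡0) z≤n , wf) separators-valid)
             (All.map (λ (_ , _ , _ , b≤n , wf , _) → b≤n , wf) witnesses-valid))
        where
          relabel-wellFormed : ∀ xs → All (λ (_ , b , τ) → b ≤ n × WellFormed τ) xs →
                               WellFormedEdges (relabel xs)
          relabel-wellFormed []       []                = _
          relabel-wellFormed (_ ∷ xs) ((b≤n , wf) ∷ ok) = b≤n , wf , relabel-wellFormed xs ok

      antecedent∈-shallow : ∀ {α} → α ∈ antecedents → Shallow α
      antecedent∈-shallow α∈ with _ , p∈ , refl ← ∈-map⁻ proj₁ α∈ = antecedent-shallow p∈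

      ⇔∈-shallow : ∀ {α α′} → α ∈ antecedents → α′ ∈ antecedents → Shallow (α ⇔ α′)
      ⇔∈-shallow {α} {α′} α∈ α′∈ = ⇔-shallow α α′ (antecedent∈-shallow α∈) (antecedent∈-shallow α′∈)

      separator∈ : ∀ {α α′ cm} → α ∈ antecedents → α′ ∈ antecedents → cm ∈ refutations (α ⇔ α′) →
                   (α , 0 , proj₁ cm) ∈ anchored
      separator∈ {α} α∈ α′∈ cm∈ = ∈-++⁺ˡ (∈-concatMap⁺′ (λ α → concatMap (separatorsFor α) antecedents) α∈
                                       (∈-concatMap⁺′ (separatorsFor α) α′∈ (∈-map⁺ _ cm∈)))

      same-label⇒equivalent : ∀ {α α′} → α ∈ antecedents → α′ ∈ antecedents → label α ≡ label α′ →
                              Equivalent α α′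
      same-label⇒equivalent {α} {α′} α∈ α′∈ same with shallowTheorem? (α ⇔ α′)
      ... | yes equivalent = equivalent
      ... | no ¬equivalent
        with (τ , wf , α⇔α′≢n) , cm∈ ← refutation-exists (α ⇔ α′) (⇔∈-shallow α∈ α′∈)
                                                        (λ ⊢α⇔α′ → ¬equivalent (⇔∈-shallow α∈ α′∈ , ⊢α⇔α′))
        = contradiction (EvaluationProperties.≡⇒⇔-≡n (⟦⟧-isEvaluation τ wf) α α′
                          (extension-≡⇒⟦⟧-≡ τ (map-≡⇒≡ _ _ anchored same (separator∈ α∈ α′∈ cm∈)))) α⇔α′≢n

      Supports : Form × Form → Form × ℕ × Tree → Set
      Supports (α , β) (α′ , b , τ) = label α′ ≡ label α → g (α , β) ≤ b ⇒ₗ ⟦ β ⟧ τ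

      separator-supports : ∀ {p x} → SeparatorEdge x → Supports p x
      separator-supports {p} {_ , _ , τ} (refl , _) _ = subst (g p ≤_) (sym (0⇒ₗ≡n (⟦ proj₂ p ⟧ τ))) (bV _)

      -- At i = n + 1 - g(α , β) we have aᵢ = g(α , β), so β is among the consequents at index i.
      witness-supports : ∀ {α β x} → (α , β) ∈ S → WitnessEdge x → Supports (α , β) x
      witness-supports {α} {β} {α′ , b , τ} αβ∈ (γ , α′γ∈ , g<n , b≤n , wf , refuted) same =
        ⊙≤⇒≤⇒ₗ (bV _) (begin
          g (α , β) ⊙ b                 ≡⟨ cong (_⊙ b) aᵢ≡g ⟨
          aᵢ i ⊙ b                      ≤⟨ proj₁ (RaPremise-≢n⇒ _ γ g<n b≤n refuted) i 1≤i i≤ ⟩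
          ⟦ consequents α′ zsV i ⟧ τ    ≤⟨ ⋀-≤ _ (∈-map⁺ proj₂ β-selected) ⟩
          ⟦ β ⟧ τ                       ∎)
        where
          open ≤-Reasoning
          open EvaluationProperties (⟦⟧-isEvaluation τ wf) using (⋀-≤)
          open ThresholdProperties.Exact J (⟦⟧-isEvaluation τ wf) n≢0 isJ using (RaPremise-≢n⇒)
          i : ℕ
          i = suc n ∸ g (α , β)
          g<1+n : g (α , β) < suc n
          g<1+n = s≤s (bV _)
          1≤i : 1 ≤ i
          1≤i = m<n⇒0<n∸m g<1+n
          i≤ : i ≤ suc n
          i≤ = m∸n≤m (suc n) (g (α , β))
          aᵢ≡g : aᵢ i ≡ g (α , β)
          aᵢ≡g = m∸[m∸n]≡n (<⇒≤ g<1+n)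
          β-selected : (α , β) ∈ selected α′ (aᵢ i) zsV
          β-selected = ∈-selected⁺ (∈-map⁺ _ αβ∈)
            (same-label⇒equivalent (∈-map⁺ proj₁ αβ∈) (∈-map⁺ proj₁ α′γ∈) (sym same) , ≤-reflexive aᵢ≡g)

      g≤⟦≻⟧root : ∀ {α β} → (α , β) ∈ S → g (α , β) ≤ ⟦ α ≻ β ⟧ root
      g≤⟦≻⟧root {α} {β} αβ∈ = subst (g (α , β) ≤_) (sym (⟦≻⟧root≡ α β))
        (conditional-≥ (relabel anchored) (label α) β (bV _) (map⁺ (++⁺
          (All.map separator-supports separators-valid)
          (All.map (witness-supports αβ∈) witnesses-valid))))

      witness-exists : ∀ {α β} → (α , β) ∈ S → g (α , β) < n →
                       ∃[ b ] ∃[ τ ] (α , b , τ) ∈ witnesses × b ≤ n × ⟦ β ⟧ τ < suc (g (α , β)) ⊙ b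
      witness-exists {α} {β} αβ∈ g<n
        with RaPremisesShallowTheorems? α β (suc (g (α , β))) zsV
      ... | yes premises = contradiction (RaFact-sound α β g<n (All.lookup (proj₁ (proj₂ V-refutes))
                             (RaFact∈Fs αβ∈ g<n (graph∈profiles S λ _ → bV _) premises))) (<⇒≱ ≤-refl)
      ... | no ¬premises
        with b , b∈ , ¬theorem ← find (¬All⇒Any¬ (shallowTheorem? ∘ witnessPremise α β) _ ¬premises)
        with cm@(τ , wf , refuted) , cm∈ ← refutation-exists (witnessPremise α β b) (witnessPremise-shallow αβ∈ b)
                                                                (λ ⊢premise → ¬theorem (witnessPremise-shallow αβ∈ b , ⊢premise))
        = b , τ , ∈-concatMap⁺′ witnessesFor αβ∈ witness∈ , b≤n ,
          proj₂ (ThresholdProperties.Exact.RaPremise-≢n⇒ J (⟦⟧-isEvaluation τ wf) n≢0 isJ _ β g<n b≤n refuted)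
        where
          b≤n : b ≤ n
          b≤n = ≤-pred (∈-upTo⁻ b∈)
          witness∈ : (α , b , τ) ∈ witnessesFor (α , β)
          witness∈ with g (α , β) <? n
          ... | yes _   = ∈-concatMap⁺′ (witnessesAt α β) b∈ (∈-map⁺ _ cm∈)
          ... | no  g≮n = contradiction g<n g≮n

      ⟦≻⟧root≤g : ∀ {α β} → (α , β) ∈ S → ⟦ α ≻ β ⟧ root ≤ g (α , β)
      ⟦≻⟧root≤g {α} {β} αβ∈ with g (α , β) <? n
      ... | no g≮n = ≤-trans (⟦⟧-≤ (α ≻ β) root root-wellFormed) (≮⇒≥ g≮n)
      ... | yes g<n with b , τ , w∈ , b≤n , β< ← witness-exists αβ∈ g<n = begin
        ⟦ α ≻ β ⟧ root                                ≡⟨ ⟦≻⟧root≡ α β ⟩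
        conditional (relabel anchored) (label α) β   ≤⟨ conditional-≤-edge _ (label α) β (∈-map⁺ _ (∈-++⁺ʳ separators w∈)) ⟩
        b ⇒ₗ ⟦ β ⟧ τ                                  ≤⟨ ≤-pred (<⊙⇒⇒ₗ< b≤n β<) ⟩
        g (α , β)                                     ∎
        where open ≤-Reasoning

      root-refutes : ⟦ χ ⟧ root ≢ n
      root-refutes χ≡n = proj₂ (proj₂ V-refutes) (trans (sym root≡V) χ≡n)
        where
          root≡V : ⟦ χ ⟧ root ≡ evalAtoms V χ
          root≡V = evaluation-≡evalAtoms (⟦⟧-isEvaluation root root-wellFormed) V χ λ a∈ →
            agrees (atoms-conditionals χ a∈)
            where
              agrees : ∀ {a} → (∃[ i ] a ≡ var i) ⊎ (∃[ p ] p ∈ S × a ≡ uncurry _≻_ p) → ⟦ a ⟧ root ≡ V a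
              agrees (inj₁ (i , refl))       = refl
              agrees (inj₂ (p , p∈ , refl)) = ≤-antisym (⟦≻⟧root≤g p∈) (g≤⟦≻⟧root p∈)

    decided : Decided χ
    decided with entails? Fs χ
    ... | inj₁ Fs⊨χ           = inj₁ (⊢-entailed (map⁺ (All.universal proj₂ facts)) Fs⊨χ)
    ... | inj₂ (V , V-refutes) = inj₂ (root , root-wellFormed , root-refutes)
      where open CounterModelFrom V V-refutes

  decided : ∀ d φ → depth φ < d → Decided φ
  decided (suc d) φ φ<1+d = Step.decided φ λ ψ ψ<φ → decided d ψ (≤-trans ψ<φ (≤-pred φ<1+d))

  ⊢-decidable : ∀ φ → Dec (⊢ φ)
  ⊢-decidable φ with decided (suc (depth φ)) φ ≤-refl
  ... | inj₁ ⊢φ              = yes ⊢φ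
  ... | inj₂ (τ , wf , φ≢n) = no λ ⊢φ → φ≢n (sound ⊢φ τ wf)

corollary3p5 : (n : ℕ) → 1 ≤ n → (J : ℕ → LForm) → IsJ n J →
    (φ : Form) → Dec (LCR⊢ n J φ)
corollary3p5 n 1≤n J isJ = Completeness.⊢-decidable n (n>0⇒n≢0 1≤n) J isJ
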